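{- There is an infinite family $\mathcal{F}$ of planar triangulations such that $\iota(G) = 2n/7$ for every $G\in\mathcal{F}$, where $n$ is the number of vertices of $G$.
   Context: A planar triangulation is a plane graph in which every face is bounded by a triangle. $\iota(G)$ denotes the minimum cardinality of a set $S\subseteq V(G)$ that is independent (no two vertices of $S$ adjacent) and dominating (every vertex of $G$ is in $S$ or adjacent to a vertex of $S$). -}

module Defs where

open import Data.Nat using (ℕ; zero; suc; _+_; _*_; _≤_)
open import Data.Fin using (Fin)
open import Data.Fin.Subset using (Subset; _∈_; _∉_; ∣_∣)
open import Data.Product using (Σ; ∃; _×_; _,_)
open import Data.Sum using (_⊎_)
open import Relation.Binary.PropositionalEquality using (_≡_; _≢_)
open import Relation.Nullary using (¬_)

iter : {A : Set} → (A → A) → ℕ → A → A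
iter f zero    x = x
iter f (suc k) x = f (iter f k x)

data Reach {D : Set} (σ α : D → D) : D → D → Set where
  here  : ∀ {d} → Reach σ α d d
  viaσ  : ∀ {d e} → Reach σ α (σ d) e → Reach σ α d e
  viaα  : ∀ {d e} → Reach σ α (α d) e → Reach σ α d e

-- A planar triangulation on the vertex set Fin n, presented as a
-- simple plane graph via its rotation system (combinatorial map):
--  * darts Fin (2m) (m = number of edges), each dart has a tail vertex;
--  * α : fixed-point-free involution pairing the two darts of an edge;
--  * σ : permutation whose cycles are exactly the sets of darts at a vertex
--        (the cyclic order of edges around the vertex in the embedding);
--  * faces are the orbits of φ = σ ∘ α; every face is a triangle
--        (φ has all orbits of length exactly 3);
--  * the map is connected and has genus 0, i.e. Euler's formula
--        V - E + F = 2 with F = 2m/3 (every face has 3 darts),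
--        equivalently 3n = m + 6;
--  * the underlying graph is simple (no loops, no parallel edges).
record PlaneTriangulation (n : ℕ) : Set where
  field
    m        : ℕ
    tail     : Fin (2 * m) → Fin n
    α        : Fin (2 * m) → Fin (2 * m)
    α-invol  : ∀ d → α (α d) ≡ d
    α-nofix  : ∀ d → α d ≢ d
    σ        : Fin (2 * m) → Fin (2 * m)
    σ⁻¹      : Fin (2 * m) → Fin (2 * m)
    σσ⁻¹     : ∀ d → σ (σ⁻¹ d) ≡ d
    σ⁻¹σ     : ∀ d → σ⁻¹ (σ d) ≡ d
    σ-tail   : ∀ d → tail (σ d) ≡ tail d
    σ-orbit  : ∀ d e → tail d ≡ tail e → ∃ λ k → iter σ k d ≡ e
    tail-onto : ∀ v → ∃ λ d → tail d ≡ v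
    face-tri : ∀ d → σ (α (σ (α (σ (α d))))) ≡ d
    face-nofix : ∀ d → σ (α d) ≢ d
    connected : ∀ d e → Reach σ α d e
    euler    : 3 * n ≡ m + 6
    no-loop  : ∀ d → tail (α d) ≢ tail d
    no-multi : ∀ d e → tail d ≡ tail e → tail (α d) ≡ tail (α e) → d ≡ e

Adj : ∀ {n} → PlaneTriangulation n → Fin n → Fin n → Set
Adj G u v = ∃ λ d → tail d ≡ u × tail (α d) ≡ v
  where open PlaneTriangulation G

Independent : ∀ {n} → PlaneTriangulation n → Subset n → Set
Independent G S = ∀ u v → u ∈ S → v ∈ S → ¬ Adj G u v

Dominating : ∀ {n} → PlaneTriangulation n → Subset n → Set
Dominating G S = ∀ v → v ∈ S ⊎ (∃ λ u → u ∈ S × Adj G u v)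

IndependentDominating : ∀ {n} → PlaneTriangulation n → Subset n → Set
IndependentDominating G S = Independent G S × Dominating G S

IsIndDomNumber : ∀ {n} → PlaneTriangulation n → ℕ → Set
IsIndDomNumber {n} G k =
  (Σ (Subset n) λ S → IndependentDominating G S × ∣ S ∣ ≡ k) ×
  (∀ S → IndependentDominating G S → k ≤ ∣ S ∣)

{-# OPTIONS --safe #-}
-- Start from the octahedron, glue t copies of a 7-vertex gadget successively
-- into faces and finally stack a vertex p into the last face, so n = 7t + 7.
-- Each gadget contains two triangles u v w whose neighbourhoods lie in an
-- octahedron u v w x y z with x y z a triangle; an independent dominating set
-- must meet such a triple, since otherwise two of x, y, z would be needed to
-- dominate u, v, w.  With the octahedron this gives 2t + 1 disjoint triples,
-- and p is dominated by itself or by a corner of its face, which lies in no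
-- triple: ι ≥ 2t + 2 = 2n/7.  Two vertices per gadget, one of the octahedron
-- and p form an independent dominating set of that size.
module Submission where

open import Defs
open import Data.Nat using (ℕ; zero; suc; _+_; _*_; _≤_; _<_; z≤n; s≤s)
import Data.Nat.Properties as ℕ
open import Data.Nat.Tactic.RingSolver using (solve-∀)
open import Data.Fin using (Fin; zero; suc; _↑ˡ_; _↑ʳ_; splitAt; toℕ; join; #_)
import Data.Fin.Properties as Fin
open import Data.Fin.Subset using (Subset; _∈_; _∉_; ∣_∣; inside; outside)
open import Data.Fin.Subset.Properties using (_∈?_; drop-there; ∣p∣≤∣x∷p∣)
open import Data.Sum using (_⊎_; inj₁; inj₂; map; map₂; [_,_])
import Data.Sum.Properties as Sum
open import Data.Sum.Function.Propositional using (_⊎-↔_)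
open import Data.Product using (Σ; ∃; _×_; _,_)
open import Data.Empty using (⊥; ⊥-elim)
open import Data.Unit using (⊤; tt)
open import Data.Bool using (Bool; true; false; T; not; _∨_)
open import Data.Bool.Properties using (T?)
import Data.Vec as Vec
open import Data.Vec using (_∷_; []; here; there)
open import Function.Base using (_∘_)
open import Function.Bundles using (_↔_; Inverse)
open import Function.Properties.Inverse using (↔-refl; ↔-sym; ↔-trans)
open import Relation.Binary.PropositionalEquality hiding ([_])
open import Relation.Nullary using (¬_; Dec; yes; no)
open import Relation.Nullary.Decidable using (True; toWitness; from-yes; map′; ¬?; _×-dec_; _→-dec_; _⊎-dec_)
open import Relation.Binary.Definitions using (DecidableEquality)

iter-+ : {A : Set} (f : A → A) (a b : ℕ) (x : A) → iter f (a + b) x ≡ iter f a (iter f b x)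
iter-+ f zero    b x = refl
iter-+ f (suc a) b x = cong f (iter-+ f a b x)

module _ {D : Set} {σ α : D → D} where

  Reach-trans : {a b c : D} → Reach σ α a b → Reach σ α b c → Reach σ α a c
  Reach-trans here     q = q
  Reach-trans (viaσ p) q = viaσ (Reach-trans p q)
  Reach-trans (viaα p) q = viaα (Reach-trans p q)

  Reach-iter : (j : ℕ) (a : D) → Reach σ α a (iter σ j a)
  Reach-iter zero    a = here
  Reach-iter (suc j) a = Reach-trans (Reach-iter j a) (viaσ here)

Orbit : {D : Set} (σ : D → D) → D → D → Set
Orbit σ x y = ∃ λ j → iter σ j x ≡ y

module _ {D : Set} {σ : D → D} where

  Orbit-refl : (x : D) → Orbit σ x x
  Orbit-refl x = 0 , refl

  Orbit-trans : {x y z : D} → Orbit σ x y → Orbit σ y z → Orbit σ x z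
  Orbit-trans {x} (j , p) (j' , q) = j' + j , trans (iter-+ σ j' j x) (trans (cong (iter σ j') p) q)

  Orbit⇒Reach : {α : D → D} {x y : D} → Orbit σ x y → Reach σ α x y
  Orbit⇒Reach (j , refl) = Reach-iter j _

-- A PlaneTriangulation whose darts form an arbitrary type with decidable
-- equality, so that inserting a gadget can simply add darts by a disjoint union.
record Triangulation (n : ℕ) : Set₁ where
  field
    Dart : Set
    _≟_ : DecidableEquality Dart
    m : ℕ
    darts : Dart ↔ Fin (2 * m)
    tail : Dart → Fin n
    α σ σ⁻¹ : Dart → Dart
    α-invol : ∀ d → α (α d) ≡ d
    α-nofix : ∀ d → α d ≢ d
    σσ⁻¹ : ∀ d → σ (σ⁻¹ d) ≡ d
    σ⁻¹σ : ∀ d → σ⁻¹ (σ d) ≡ d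
    σ-tail : ∀ d → tail (σ d) ≡ tail d
    σ-orbit : ∀ d e → tail d ≡ tail e → Orbit σ d e
    tail-onto : ∀ v → ∃ λ d → tail d ≡ v
    face-tri : ∀ d → σ (α (σ (α (σ (α d))))) ≡ d
    face-nofix : ∀ d → σ (α d) ≢ d
    connected : ∀ d e → Reach σ α d e
    euler : 3 * n ≡ m + 6
    no-loop : ∀ d → tail (α d) ≢ tail d
    no-multi : ∀ d e → tail d ≡ tail e → tail (α d) ≡ tail (α e) → d ≡ e

module _ {n : ℕ} (G : Triangulation n) where
  open Triangulation G

  Adjacent : Fin n → Fin n → Set
  Adjacent u w = ∃ λ d → tail d ≡ u × tail (α d) ≡ w

  Adjacent-sym : ∀ {u w} → Adjacent u w → Adjacent w u
  Adjacent-sym (d , p , q) = α d , q , trans (cong tail (α-invol d)) p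

  Adjacent-irrefl : ∀ {u} → ¬ Adjacent u u
  Adjacent-irrefl (d , p , q) = no-loop d (trans q (sym p))

  IsIndependent IsDominating : Subset n → Set
  IsIndependent S = ∀ a b → a ∈ S → b ∈ S → ¬ Adjacent a b
  IsDominating S = ∀ q → q ∈ S ⊎ ∃ λ s → s ∈ S × Adjacent s q

module ToPlane {n : ℕ} (G : Triangulation n) where
  open Triangulation G
  open Inverse darts using (to; from; strictlyInverseˡ; strictlyInverseʳ)

  from-injective : ∀ i j → from i ≡ from j → i ≡ j
  from-injective i j p = trans (sym (strictlyInverseˡ i)) (trans (cong to p) (strictlyInverseˡ j))

  lift : (Dart → Dart) → Fin (2 * m) → Fin (2 * m)
  lift g i = to (g (from i))

  lift-iter : ∀ j i → iter (lift σ) j i ≡ to (iter σ j (from i))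
  lift-iter zero    i = sym (strictlyInverseˡ i)
  lift-iter (suc j) i rewrite lift-iter j i | strictlyInverseʳ (iter σ j (from i)) = refl

  lift-Reach : ∀ {x y} → Reach σ α x y → Reach (lift σ) (lift α) (to x) (to y)
  lift-Reach here = here
  lift-Reach {x} (viaσ r) =
    viaσ (subst (λ z → Reach (lift σ) (lift α) (to (σ z)) _) (sym (strictlyInverseʳ x)) (lift-Reach r))
  lift-Reach {x} (viaα r) =
    viaα (subst (λ z → Reach (lift σ) (lift α) (to (α z)) _) (sym (strictlyInverseʳ x)) (lift-Reach r))

  from-lift : ∀ (g : Dart → Dart) i → from (lift g i) ≡ g (from i)
  from-lift g i = strictlyInverseʳ (g (from i))

  plane : PlaneTriangulation n
  plane = record
    { m = m ; tail = tail ∘ from ; α = lift α ; σ = lift σ ; σ⁻¹ = lift σ⁻¹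
    ; α-invol = λ i → trans (cong to (trans (cong α (from-lift α i)) (α-invol (from i)))) (strictlyInverseˡ i)
    ; α-nofix = λ i p → α-nofix (from i) (trans (sym (from-lift α i)) (cong from p))
    ; σσ⁻¹ = λ i → trans (cong to (trans (cong σ (from-lift σ⁻¹ i)) (σσ⁻¹ (from i)))) (strictlyInverseˡ i)
    ; σ⁻¹σ = λ i → trans (cong to (trans (cong σ⁻¹ (from-lift σ i)) (σ⁻¹σ (from i)))) (strictlyInverseˡ i)
    ; σ-tail = λ i → trans (cong tail (from-lift σ i)) (σ-tail (from i))
    ; σ-orbit = λ i j p → let (k , q) = σ-orbit (from i) (from j) p in
                          k , trans (lift-iter k i) (trans (cong to q) (strictlyInverseˡ j))
    ; tail-onto = λ w → let (x , p) = tail-onto w in to x , trans (cong tail (strictlyInverseʳ x)) p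
    ; face-tri = λ i → from-injective _ i
                 (trans (φ-from _) (trans (cong φ (trans (φ-from _) (cong φ (φ-from i)))) (face-tri (from i))))
    ; face-nofix = λ i p → face-nofix (from i) (trans (sym (φ-from i)) (cong from p))
    ; connected = λ i j → subst₂ (Reach (lift σ) (lift α)) (strictlyInverseˡ i) (strictlyInverseˡ j)
                            (lift-Reach (connected (from i) (from j)))
    ; euler = euler
    ; no-loop = λ i p → no-loop (from i) (trans (cong tail (sym (from-lift α i))) p)
    ; no-multi = λ i j p q → from-injective i j (no-multi (from i) (from j) p
                   (trans (cong tail (sym (from-lift α i))) (trans q (cong tail (from-lift α j)))))
    }
    where
    φ : Dart → Dart
    φ x = σ (α x)
    φ-from : ∀ i → from (lift σ (lift α i)) ≡ φ (from i)
    φ-from i = trans (from-lift σ (lift α i)) (cong σ (from-lift α i))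

  Adj⇒Adjacent : ∀ {u w} → Adj plane u w → Adjacent G u w
  Adj⇒Adjacent (i , p , q) = from i , p , trans (cong tail (sym (from-lift α i))) q

  Adjacent⇒Adj : ∀ {u w} → Adjacent G u w → Adj plane u w
  Adjacent⇒Adj (x , p , q) =
    to x , trans (cong tail (strictlyInverseʳ x)) p ,
    trans (cong tail (trans (from-lift α (to x)) (cong α (strictlyInverseʳ x)))) q

  independent : ∀ {S} → IsIndependent G S → Independent plane S
  independent ind a b a∈S b∈S = ind a b a∈S b∈S ∘ Adj⇒Adjacent

  independent⁻ : ∀ {S} → Independent plane S → IsIndependent G S
  independent⁻ ind a b a∈S b∈S = ind a b a∈S b∈S ∘ Adjacent⇒Adj

  dominating : ∀ {S} → IsDominating G S → Dominating plane S
  dominating dom q = map₂ (λ (s , s∈S , adj) → s , s∈S , Adjacent⇒Adj adj) (dom q)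

  dominating⁻ : ∀ {S} → Dominating plane S → IsDominating G S
  dominating⁻ dom q = map₂ (λ (s , s∈S , adj) → s , s∈S , Adj⇒Adjacent adj) (dom q)

  IsIndDomNumber-plane : ∀ {k} → (∃ λ S → (IsIndependent G S × IsDominating G S) × ∣ S ∣ ≡ k) →
    (∀ S → IsIndependent G S → IsDominating G S → k ≤ ∣ S ∣) → IsIndDomNumber plane k
  IsIndDomNumber-plane (S , (ind , dom) , |S|≡k) minimal =
    (S , (independent ind , dominating dom) , |S|≡k) ,
    λ S (ind , dom) → minimal S (independent⁻ ind) (dominating⁻ dom)

record OctahedralTriple {n : ℕ} (G : Triangulation n) (u v w : Fin n) : Set where
  field
    x y z : Fin n
    nbr-u : ∀ s → Adjacent G s u → s ≡ v ⊎ s ≡ w ⊎ s ≡ y ⊎ s ≡ z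
    nbr-v : ∀ s → Adjacent G s v → s ≡ u ⊎ s ≡ w ⊎ s ≡ x ⊎ s ≡ z
    nbr-w : ∀ s → Adjacent G s w → s ≡ u ⊎ s ≡ v ⊎ s ≡ x ⊎ s ≡ y
    x-y : Adjacent G x y
    y-z : Adjacent G y z
    x-z : Adjacent G x z

Meets : ∀ {n} → Subset n → Fin n → Fin n → Fin n → Set
Meets S u v w = u ∈ S ⊎ v ∈ S ⊎ w ∈ S

module _ {n : ℕ} {G : Triangulation n} {S : Subset n} (ind : IsIndependent G S) (dom : IsDominating G S) where

  dominated-by-last-two : ∀ {a p q r s} → a ∉ S → p ∉ S → q ∉ S →
    (∀ t → Adjacent G t a → t ≡ p ⊎ t ≡ q ⊎ t ≡ r ⊎ t ≡ s) → r ∈ S ⊎ s ∈ S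
  dominated-by-last-two a∉S p∉S q∉S nbr with dom _
  ... | inj₁ a∈S = ⊥-elim (a∉S a∈S)
  ... | inj₂ (t , t∈S , adj) with nbr t adj
  ...   | inj₁ refl                = ⊥-elim (p∉S t∈S)
  ...   | inj₂ (inj₁ refl)         = ⊥-elim (q∉S t∈S)
  ...   | inj₂ (inj₂ (inj₁ refl))  = inj₁ t∈S
  ...   | inj₂ (inj₂ (inj₂ refl))  = inj₂ t∈S

  -- Otherwise u, v, w are dominated from {y, z}, {x, z}, {x, y}, which forces
  -- two vertices of the triangle x y z into S.
  meets-octahedral : ∀ {u v w} → OctahedralTriple G u v w → Meets S u v w
  meets-octahedral {u} {v} {w} O with u ∈? S | v ∈? S | w ∈? S
  ... | yes u∈S | _       | _       = inj₁ u∈S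
  ... | no _    | yes v∈S | _       = inj₂ (inj₁ v∈S)
  ... | no _    | no _    | yes w∈S = inj₂ (inj₂ w∈S)
  ... | no u∉S  | no v∉S  | no w∉S  = ⊥-elim (triangle
          (dominated-by-last-two u∉S v∉S w∉S nbr-u)
          (dominated-by-last-two v∉S u∉S w∉S nbr-v)
          (dominated-by-last-two w∉S u∉S v∉S nbr-w))
    where
    open OctahedralTriple O
    triangle : y ∈ S ⊎ z ∈ S → x ∈ S ⊎ z ∈ S → x ∈ S ⊎ y ∈ S → ⊥
    triangle (inj₁ y∈S) (inj₁ x∈S) _          = ind x y x∈S y∈S x-y
    triangle (inj₁ y∈S) (inj₂ z∈S) _          = ind y z y∈S z∈S y-z
    triangle (inj₂ z∈S) _          (inj₁ x∈S) = ind x z x∈S z∈S x-z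
    triangle (inj₂ z∈S) _          (inj₂ y∈S) = ind y z y∈S z∈S y-z

next3 prev3 : Fin 3 → Fin 3
next3 zero             = suc zero
next3 (suc zero)       = suc (suc zero)
next3 (suc (suc zero)) = zero
prev3 zero             = suc (suc zero)
prev3 (suc zero)       = zero
prev3 (suc (suc zero)) = suc zero

-- The face containing the dart d: side i leaves corner i along the face,
-- and preSide i is the dart at corner i just before side i in the rotation.
module Face {n : ℕ} (G : Triangulation n) (d : Triangulation.Dart G) where
  open Triangulation G

  φ : Dart → Dart
  φ x = σ (α x)

  side : Fin 3 → Dart
  side zero             = d
  side (suc zero)       = φ d
  side (suc (suc zero)) = φ (φ d)

  φ-side : ∀ i → φ (side i) ≡ side (next3 i)
  φ-side zero             = refl
  φ-side (suc zero)       = refl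
  φ-side (suc (suc zero)) = face-tri d

  preSide : Fin 3 → Dart
  preSide i = α (side (prev3 i))

  α-side : ∀ i → α (side i) ≡ preSide (next3 i)
  α-side zero             = refl
  α-side (suc zero)       = refl
  α-side (suc (suc zero)) = refl

  σ-preSide : ∀ i → σ (preSide i) ≡ side i
  σ-preSide zero             = φ-side (suc (suc zero))
  σ-preSide (suc zero)       = φ-side zero
  σ-preSide (suc (suc zero)) = φ-side (suc zero)

  σ⁻¹-side : ∀ i → σ⁻¹ (side i) ≡ preSide i
  σ⁻¹-side i = trans (cong σ⁻¹ (sym (σ-preSide i))) (σ⁻¹σ (preSide i))

  corner : Fin 3 → Fin n
  corner i = tail (side i)

  tail-preSide : ∀ i → tail (preSide i) ≡ corner i
  tail-preSide i = trans (sym (σ-tail (preSide i))) (cong tail (σ-preSide i))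

  tail-α-side : ∀ i → tail (α (side i)) ≡ corner (next3 i)
  tail-α-side i = trans (sym (σ-tail (α (side i)))) (cong tail (φ-side i))

  corner-next : ∀ i → corner (next3 i) ≢ corner i
  corner-next i eq = no-loop (side i) (trans (tail-α-side i) eq)

  corner-injective : ∀ i j → corner i ≡ corner j → i ≡ j
  corner-injective zero             zero             e = refl
  corner-injective zero             (suc zero)       e = ⊥-elim (corner-next zero (sym e))
  corner-injective zero             (suc (suc zero)) e = ⊥-elim (corner-next (suc (suc zero)) e)
  corner-injective (suc zero)       zero             e = ⊥-elim (corner-next zero e)
  corner-injective (suc zero)       (suc zero)       e = refl
  corner-injective (suc zero)       (suc (suc zero)) e = ⊥-elim (corner-next (suc zero) (sym e))
  corner-injective (suc (suc zero)) zero             e = ⊥-elim (corner-next (suc (suc zero)) (sym e))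
  corner-injective (suc (suc zero)) (suc zero)       e = ⊥-elim (corner-next (suc zero) e)
  corner-injective (suc (suc zero)) (suc (suc zero)) e = refl

  corner-adjacent : ∀ i → Adjacent G (corner i) (corner (next3 i))
  corner-adjacent i = side i , refl , tail-α-side i

  side-injective : ∀ i j → side i ≡ side j → i ≡ j
  side-injective i j e = corner-injective i j (cong tail e)

  preSide-injective : ∀ i j → preSide i ≡ preSide j → i ≡ j
  preSide-injective i j e = corner-injective i j (trans (sym (tail-preSide i)) (trans (cong tail e) (tail-preSide j)))

  α-injective : ∀ x y → α x ≡ α y → x ≡ y
  α-injective x y e = trans (sym (α-invol x)) (trans (cong α e) (α-invol y))

  φ-avoids-sides : ∀ x → (∀ i → x ≢ side i) → ∀ i → φ x ≢ side i
  φ-avoids-sides x x∉ i p = x∉ (next3 (next3 i))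
    (trans (sym (face-tri x)) (trans (cong (λ z → φ (φ z)) p) (trans (cong φ (φ-side i)) (φ-side (next3 i)))))

isNew : ∀ {v} → Fin 3 ⊎ Fin v → Bool
isNew (inj₁ _) = false
isNew (inj₂ _) = true

-- A triangulated disc with nv interior vertices bounded by a triangle whose
-- corners are inj₁ i, to be glued into a face.  Gluing into a face with sides
-- side i and preSides preSide i (see Face), the gadget darts at corner i are
-- spliced into the rotation as  preSide i ↦ entry i ↦ … ↦ last i ↦ side i,
-- and lσ l = inj₂ i (lσ⁻¹ l = inj₂ i) records that the rotation leaves the
-- gadget towards side i (preSide i).
record Gadget : Set where
  field
    nv ne nd : ℕ
    ltail : Fin nd → Fin 3 ⊎ Fin nv
    lα : Fin nd → Fin nd
    lσ lσ⁻¹ : Fin nd → Fin nd ⊎ Fin 3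
    entry last : Fin 3 → Fin nd

-- In lφ and lσ⁻¹′ the element inj₂ i stands for side i, in lσ′ for preSide i.
module GadgetOps (R : Gadget) where
  open Gadget R

  lφ : Fin nd ⊎ Fin 3 → Fin nd ⊎ Fin 3
  lφ (inj₁ l) = lσ (lα l)
  lφ (inj₂ i) = inj₁ (entry (next3 i))

  lσ⁻¹′ : Fin nd ⊎ Fin 3 → Fin nd ⊎ Fin 3
  lσ⁻¹′ (inj₁ l) = lσ⁻¹ l
  lσ⁻¹′ (inj₂ i) = inj₁ (last i)

  lσ′ : Fin nd ⊎ Fin 3 → Fin nd ⊎ Fin 3
  lσ′ (inj₁ l) = lσ l
  lσ′ (inj₂ i) = inj₁ (entry i)

  ltail′ : Fin nd ⊎ Fin 3 → Fin 3 ⊎ Fin nv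
  ltail′ (inj₁ l) = ltail l
  ltail′ (inj₂ i) = inj₁ i

  lσ^ : ℕ → Fin nd → Fin nd ⊎ Fin 3
  lσ^ zero    l = inj₁ l
  lσ^ (suc j) l with lσ^ j l
  ... | inj₁ l′ = lσ l′
  ... | inj₂ i  = inj₂ i

record IsGadget (R : Gadget) : Set where
  open Gadget R
  open GadgetOps R
  field
    nd≡2ne : nd ≡ 2 * ne
    ne≡3nv : ne ≡ 3 * nv
    α-invol : ∀ l → lα (lα l) ≡ l
    α-nofix : ∀ l → lα l ≢ l
    σ⁻¹σ : ∀ l → lσ⁻¹′ (lσ l) ≡ inj₁ l
    σσ⁻¹ : ∀ l → lσ′ (lσ⁻¹ l) ≡ inj₁ l
    σ-last : ∀ i → lσ (last i) ≡ inj₂ i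
    σ⁻¹-entry : ∀ i → lσ⁻¹ (entry i) ≡ inj₂ i
    σ-tail : ∀ l → ltail′ (lσ l) ≡ ltail l
    tail-entry : ∀ i → ltail (entry i) ≡ inj₁ i
    no-loop : ∀ l → ltail (lα l) ≢ ltail l
    no-multi : ∀ l l′ → ltail l ≡ ltail l′ → ltail (lα l) ≡ ltail (lα l′) → l ≡ l′
    no-corner-edge : ∀ l → T (isNew (ltail l) ∨ isNew (ltail (lα l)))
    tail-onto : ∀ j → ∃ λ l → ltail l ≡ inj₂ j
    face-tri : ∀ y → lφ (lφ (lφ y)) ≡ y
    face-nofix : ∀ y → lφ y ≢ y
    -- the rotation conditions needed for σ-orbit and connectivity of the glued
    -- map, phrased as bounded searches so that they are decidable
    orbit-new : ∀ l l′ → ltail l ≡ ltail l′ → T (isNew (ltail l)) →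
                ∃ λ (j : Fin nd) → lσ^ (toℕ j) l ≡ inj₁ l′
    orbit-entry : ∀ l i → ltail l ≡ inj₁ i → ∃ λ (j : Fin nd) → lσ^ (toℕ j) (entry i) ≡ inj₁ l
    orbit-last : ∀ l i → ltail l ≡ inj₁ i → ∃ λ (j : Fin nd) → lσ^ (toℕ j) l ≡ inj₁ (last i)
    new-to-corner : ∀ l → T (isNew (ltail l)) →
                    ∃ λ (j : Fin nd) → ∃ λ l₀ → lσ^ (toℕ j) l ≡ inj₁ l₀ × T (not (isNew (ltail (lα l₀))))
    corner-to-new : ∀ l → T (isNew (ltail l)) →
                    ∃ λ l₀ → ∃ λ (j : Fin nd) → T (not (isNew (ltail l₀))) × lσ^ (toℕ j) (lα l₀) ≡ inj₁ l

all⊎? : {A B : Set} {P : A ⊎ B → Set} → Dec (∀ a → P (inj₁ a)) → Dec (∀ b → P (inj₂ b)) → Dec (∀ x → P x)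
all⊎? p q = map′ (λ (f , g) → [ f , g ]) (λ h → h ∘ inj₁ , h ∘ inj₂) (p ×-dec q)

module GadgetDecisions (R : Gadget) where
  open Gadget R
  open GadgetOps R

  _≟ᵥ_ : DecidableEquality (Fin 3 ⊎ Fin nv)
  _≟ᵥ_ = Sum.≡-dec Fin._≟_ Fin._≟_

  _≟ₗ_ : DecidableEquality (Fin nd ⊎ Fin 3)
  _≟ₗ_ = Sum.≡-dec Fin._≟_ Fin._≟_

  -- The implicit arguments reduce to ⊤ for a concrete valid gadget and are
  -- then filled in automatically, as for Data.Fin.#_.
  valid : {_ : True (nd ℕ.≟ 2 * ne)} {_ : True (ne ℕ.≟ 3 * nv)}
    {_ : True (Fin.all? λ l → lα (lα l) Fin.≟ l)}
    {_ : True (Fin.all? λ l → ¬? (lα l Fin.≟ l))}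
    {_ : True (Fin.all? λ l → lσ⁻¹′ (lσ l) ≟ₗ inj₁ l)}
    {_ : True (Fin.all? λ l → lσ′ (lσ⁻¹ l) ≟ₗ inj₁ l)}
    {_ : True (Fin.all? λ i → lσ (last i) ≟ₗ inj₂ i)}
    {_ : True (Fin.all? λ i → lσ⁻¹ (entry i) ≟ₗ inj₂ i)}
    {_ : True (Fin.all? λ l → ltail′ (lσ l) ≟ᵥ ltail l)}
    {_ : True (Fin.all? λ i → ltail (entry i) ≟ᵥ inj₁ i)}
    {_ : True (Fin.all? λ l → ¬? (ltail (lα l) ≟ᵥ ltail l))}
    {_ : True (Fin.all? λ l → Fin.all? λ l′ →
           (ltail l ≟ᵥ ltail l′) →-dec (ltail (lα l) ≟ᵥ ltail (lα l′)) →-dec (l Fin.≟ l′))}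
    {_ : True (Fin.all? λ l → T? (isNew (ltail l) ∨ isNew (ltail (lα l))))}
    {_ : True (Fin.all? λ j → Fin.any? λ l → ltail l ≟ᵥ inj₂ j)}
    {_ : True (all⊎? (Fin.all? λ l → lφ (lφ (lφ (inj₁ l))) ≟ₗ inj₁ l)
                     (Fin.all? λ i → lφ (lφ (lφ (inj₂ i))) ≟ₗ inj₂ i))}
    {_ : True (all⊎? (Fin.all? λ l → ¬? (lφ (inj₁ l) ≟ₗ inj₁ l)) (Fin.all? λ i → ¬? (lφ (inj₂ i) ≟ₗ inj₂ i)))}
    {_ : True (Fin.all? λ l → Fin.all? λ l′ → (ltail l ≟ᵥ ltail l′) →-dec T? (isNew (ltail l)) →-dec
           Fin.any? λ j → lσ^ (toℕ j) l ≟ₗ inj₁ l′)}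
    {_ : True (Fin.all? λ l → Fin.all? λ i → (ltail l ≟ᵥ inj₁ i) →-dec
           Fin.any? λ j → lσ^ (toℕ j) (entry i) ≟ₗ inj₁ l)}
    {_ : True (Fin.all? λ l → Fin.all? λ i → (ltail l ≟ᵥ inj₁ i) →-dec
           Fin.any? λ j → lσ^ (toℕ j) l ≟ₗ inj₁ (last i))}
    {_ : True (Fin.all? λ l → T? (isNew (ltail l)) →-dec Fin.any? λ j → Fin.any? λ l₀ →
           (lσ^ (toℕ j) l ≟ₗ inj₁ l₀) ×-dec T? (not (isNew (ltail (lα l₀)))))}
    {_ : True (Fin.all? λ l → T? (isNew (ltail l)) →-dec Fin.any? λ l₀ → Fin.any? λ j →
           T? (not (isNew (ltail l₀))) ×-dec (lσ^ (toℕ j) (lα l₀) ≟ₗ inj₁ l))}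
    → IsGadget R
  valid {p₁} {p₂} {p₃} {p₄} {p₅} {p₆} {p₇} {p₈} {p₉} {p₁₀} {p₁₁}
        {p₁₂} {p₁₃} {p₁₄} {p₁₅} {p₁₆} {p₁₇} {p₁₈} {p₁₉} {p₂₀} {p₂₁} =
    record
      { nd≡2ne = toWitness p₁ ; ne≡3nv = toWitness p₂ ; α-invol = toWitness p₃ ; α-nofix = toWitness p₄
      ; σ⁻¹σ = toWitness p₅ ; σσ⁻¹ = toWitness p₆ ; σ-last = toWitness p₇ ; σ⁻¹-entry = toWitness p₈
      ; σ-tail = toWitness p₉ ; tail-entry = toWitness p₁₀ ; no-loop = toWitness p₁₁ ; no-multi = toWitness p₁₂
      ; no-corner-edge = toWitness p₁₃ ; tail-onto = toWitness p₁₄ ; face-tri = toWitness p₁₅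
      ; face-nofix = toWitness p₁₆ ; orbit-new = toWitness p₁₇ ; orbit-entry = toWitness p₁₈
      ; orbit-last = toWitness p₁₉ ; new-to-corner = toWitness p₂₀ ; corner-to-new = toWitness p₂₁ }

  neighbours? : ∀ j A B C E →
    Dec (∀ l → ltail (lα l) ≡ inj₂ j → ltail l ≡ A ⊎ ltail l ≡ B ⊎ ltail l ≡ C ⊎ ltail l ≡ E)
  neighbours? j A B C E = Fin.all? λ l → (ltail (lα l) ≟ᵥ inj₂ j) →-dec
    ((ltail l ≟ᵥ A) ⊎-dec (ltail l ≟ᵥ B) ⊎-dec (ltail l ≟ᵥ C) ⊎-dec (ltail l ≟ᵥ E))

  only-corner-neighbours? : ∀ j → Dec (∀ l → ltail (lα l) ≡ inj₂ j → T (not (isNew (ltail l))))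
  only-corner-neighbours? j = Fin.all? λ l → (ltail (lα l) ≟ᵥ inj₂ j) →-dec T? (not (isNew (ltail l)))

  nonadjacent? : ∀ A B → Dec (∀ l → ltail l ≡ A ⊎ ltail l ≡ B → ¬ (ltail (lα l) ≡ A ⊎ ltail (lα l) ≡ B))
  nonadjacent? A B = Fin.all? λ l → ((ltail l ≟ᵥ A) ⊎-dec (ltail l ≟ᵥ B)) →-dec
    ¬? ((ltail (lα l) ≟ᵥ A) ⊎-dec (ltail (lα l) ≟ᵥ B))

↑ˡ≢↑ʳ : ∀ {v n} (j : Fin v) (u : Fin n) → j ↑ˡ n ≢ v ↑ʳ u
↑ˡ≢↑ʳ {v} {n} j u eq = ℕ.<⇒≢ (ℕ.≤-trans (Fin.toℕ<n j) (ℕ.m≤m+n v (toℕ u)))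
  (trans (sym (Fin.toℕ-↑ˡ j n)) (trans (cong toℕ eq) (Fin.toℕ-↑ʳ v u)))

cong-⊎⁴ : {A B : Set} (g : A → B) {s a b c e : A} →
  s ≡ a ⊎ s ≡ b ⊎ s ≡ c ⊎ s ≡ e → g s ≡ g a ⊎ g s ≡ g b ⊎ g s ≡ g c ⊎ g s ≡ g e
cong-⊎⁴ g = map (cong g) (map (cong g) (map (cong g) (cong g)))

module Insertion {n : ℕ} (G : Triangulation n) (d : Triangulation.Dart G) (R : Gadget) (ok : IsGadget R) where
  open Triangulation G
  open Face G d public
  open Gadget R
  open GadgetOps R
  module Ok = IsGadget ok

  data Among (h : Fin 3 → Dart) (e : Dart) : Set where
    hit  : ∀ i → e ≡ h i → Among h e
    miss : (∀ i → e ≢ h i) → Among h e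

  among : (h : Fin 3 → Dart) (e : Dart) → Among h e
  among h e with e ≟ h zero | e ≟ h (suc zero) | e ≟ h (suc (suc zero))
  ... | yes p | _     | _     = hit zero p
  ... | no _  | yes p | _     = hit (suc zero) p
  ... | no _  | no _  | yes p = hit (suc (suc zero)) p
  ... | no p  | no q  | no r  = miss λ { zero → p ; (suc zero) → q ; (suc (suc zero)) → r }

  Dart′ : Set
  Dart′ = Fin nd ⊎ Dart

  vertex : Fin 3 ⊎ Fin nv → Fin (nv + n)
  vertex (inj₁ i) = nv ↑ʳ corner i
  vertex (inj₂ j) = j ↑ˡ n

  vertex-injective : ∀ x y → vertex x ≡ vertex y → x ≡ y
  vertex-injective (inj₁ i) (inj₁ j) e = cong inj₁ (corner-injective i j (Fin.↑ʳ-injective nv (corner i) (corner j) e))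
  vertex-injective (inj₁ i) (inj₂ j) e = ⊥-elim (↑ˡ≢↑ʳ j (corner i) (sym e))
  vertex-injective (inj₂ i) (inj₁ j) e = ⊥-elim (↑ˡ≢↑ʳ i (corner j) e)
  vertex-injective (inj₂ i) (inj₂ j) e = cong inj₂ (Fin.↑ˡ-injective n i j e)

  vertex-old : ∀ x u → vertex x ≡ nv ↑ʳ u → ∃ λ i → x ≡ inj₁ i
  vertex-old (inj₁ i) u e = i , refl
  vertex-old (inj₂ j) u e = ⊥-elim (↑ˡ≢↑ʳ j u e)

  vertex-new : ∀ x u → vertex x ≡ nv ↑ʳ u → ¬ T (isNew x)
  vertex-new (inj₂ j) u e _ = ↑ˡ≢↑ʳ j u e

  not-new : ∀ (x : Fin 3 ⊎ Fin nv) → T (not (isNew x)) → ∃ λ i → x ≡ inj₁ i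
  not-new (inj₁ i) _ = i , refl

  isNew-inj₂ : ∀ {x : Fin 3 ⊎ Fin nv} {j} → x ≡ inj₂ j → T (isNew x)
  isNew-inj₂ refl = tt

  tail′ : Dart′ → Fin (nv + n)
  tail′ (inj₁ l) = vertex (ltail l)
  tail′ (inj₂ e) = nv ↑ʳ tail e

  α′ : Dart′ → Dart′
  α′ (inj₁ l) = inj₁ (lα l)
  α′ (inj₂ e) = inj₂ (α e)

  atSide atPreSide : Fin nd ⊎ Fin 3 → Dart′
  atSide (inj₁ l) = inj₁ l
  atSide (inj₂ i) = inj₂ (side i)
  atPreSide (inj₁ l) = inj₁ l
  atPreSide (inj₂ i) = inj₂ (preSide i)

  σ-old : ∀ e → Among preSide e → Dart′
  σ-old e (hit i _) = inj₁ (entry i)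
  σ-old e (miss _)  = inj₂ (σ e)

  σ⁻¹-old : ∀ e → Among side e → Dart′
  σ⁻¹-old e (hit i _) = inj₁ (last i)
  σ⁻¹-old e (miss _)  = inj₂ (σ⁻¹ e)

  σ′ σ⁻¹′ : Dart′ → Dart′
  σ′ (inj₁ l) = atSide (lσ l)
  σ′ (inj₂ e) = σ-old e (among preSide e)
  σ⁻¹′ (inj₁ l) = atPreSide (lσ⁻¹ l)
  σ⁻¹′ (inj₂ e) = σ⁻¹-old e (among side e)

  σ′-preSide : ∀ i → σ′ (inj₂ (preSide i)) ≡ inj₁ (entry i)
  σ′-preSide i with among preSide (preSide i)
  ... | hit j p rewrite preSide-injective i j p = refl
  ... | miss q = ⊥-elim (q i refl)

  σ′-old : ∀ e → (∀ i → e ≢ preSide i) → σ′ (inj₂ e) ≡ inj₂ (σ e)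
  σ′-old e q with among preSide e
  ... | hit j p = ⊥-elim (q j p)
  ... | miss _  = refl

  σ⁻¹′-side : ∀ i → σ⁻¹′ (inj₂ (side i)) ≡ inj₁ (last i)
  σ⁻¹′-side i with among side (side i)
  ... | hit j p rewrite side-injective i j p = refl
  ... | miss q = ⊥-elim (q i refl)

  α-invol′ : ∀ x → α′ (α′ x) ≡ x
  α-invol′ (inj₁ l) = cong inj₁ (Ok.α-invol l)
  α-invol′ (inj₂ e) = cong inj₂ (α-invol e)

  α-nofix′ : ∀ x → α′ x ≢ x
  α-nofix′ (inj₁ l) eq = Ok.α-nofix l (Sum.inj₁-injective eq)
  α-nofix′ (inj₂ e) eq = α-nofix e (Sum.inj₂-injective eq)

  σσ⁻¹′ : ∀ x → σ′ (σ⁻¹′ x) ≡ x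
  σσ⁻¹′ (inj₁ l) with lσ⁻¹ l | Ok.σσ⁻¹ l
  ... | inj₁ l′ | p = cong atSide p
  ... | inj₂ i  | p = trans (σ′-preSide i) (cong atSide p)
  σσ⁻¹′ (inj₂ e) with among side e
  ... | hit i refl = cong atSide (Ok.σ-last i)
  ... | miss q with among preSide (σ⁻¹ e)
  ...   | hit i p = ⊥-elim (q i (trans (sym (σσ⁻¹ e)) (trans (cong σ p) (σ-preSide i))))
  ...   | miss _  = cong inj₂ (σσ⁻¹ e)

  σ⁻¹σ′ : ∀ x → σ⁻¹′ (σ′ x) ≡ x
  σ⁻¹σ′ (inj₁ l) with lσ l | Ok.σ⁻¹σ l
  ... | inj₁ l′ | p = cong atPreSide p
  ... | inj₂ i  | p = trans (σ⁻¹′-side i) (cong atPreSide p)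
  σ⁻¹σ′ (inj₂ e) with among preSide e
  ... | hit i refl = cong atPreSide (Ok.σ⁻¹-entry i)
  ... | miss q with among side (σ e)
  ...   | hit i p = ⊥-elim (q i (trans (sym (σ⁻¹σ e)) (trans (cong σ⁻¹ p) (σ⁻¹-side i))))
  ...   | miss _  = cong inj₂ (σ⁻¹σ e)

  tail-atSide : ∀ y → tail′ (atSide y) ≡ vertex (ltail′ y)
  tail-atSide (inj₁ l) = refl
  tail-atSide (inj₂ i) = refl

  σ-tail′ : ∀ x → tail′ (σ′ x) ≡ tail′ x
  σ-tail′ (inj₁ l) = trans (tail-atSide (lσ l)) (cong vertex (Ok.σ-tail l))
  σ-tail′ (inj₂ e) with among preSide e
  ... | hit i refl = trans (cong vertex (Ok.tail-entry i)) (cong (nv ↑ʳ_) (sym (tail-preSide i)))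
  ... | miss _     = cong (nv ↑ʳ_) (σ-tail e)

  lσ^-orbit : ∀ j l l′ → lσ^ j l ≡ inj₁ l′ → iter σ′ j (inj₁ l) ≡ inj₁ l′
  lσ^-orbit zero    l l′ eq = cong atSide eq
  lσ^-orbit (suc j) l l′ eq with lσ^ j l in e₀
  ... | inj₁ l″ rewrite lσ^-orbit j l l″ e₀ = cong atSide eq

  local-orbit : ∀ (j : Fin nd) l l′ → lσ^ (toℕ j) l ≡ inj₁ l′ → Orbit σ′ (inj₁ l) (inj₁ l′)
  local-orbit j l l′ eq = toℕ j , lσ^-orbit (toℕ j) l l′ eq

  orbit-to-side : ∀ l i → ltail l ≡ inj₁ i → Orbit σ′ (inj₁ l) (inj₂ (side i))
  orbit-to-side l i el with Ok.orbit-last l i el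
  ... | j , eq = Orbit-trans (local-orbit j l (last i) eq) (1 , cong atSide (Ok.σ-last i))

  orbit-from-preSide : ∀ l i → ltail l ≡ inj₁ i → Orbit σ′ (inj₂ (preSide i)) (inj₁ l)
  orbit-from-preSide l i el with Ok.orbit-entry l i el
  ... | j , eq = Orbit-trans (1 , σ′-preSide i) (local-orbit j (entry i) l eq)

  orbit-σ : ∀ e → Orbit σ′ (inj₂ e) (inj₂ (σ e))
  orbit-σ e with among preSide e
  ... | hit i refl = Orbit-trans (orbit-from-preSide (entry i) i (Ok.tail-entry i))
                       (subst (λ z → Orbit σ′ (inj₁ (entry i)) (inj₂ z)) (sym (σ-preSide i))
                         (orbit-to-side (entry i) i (Ok.tail-entry i)))
  ... | miss q = 1 , σ′-old e q

  orbit-iter : ∀ k e → Orbit σ′ (inj₂ e) (inj₂ (iter σ k e))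
  orbit-iter zero    e = Orbit-refl _
  orbit-iter (suc k) e = Orbit-trans (orbit-iter k e) (orbit-σ (iter σ k e))

  orbit-old : ∀ e e′ → tail e ≡ tail e′ → Orbit σ′ (inj₂ e) (inj₂ e′)
  orbit-old e e′ p with σ-orbit e e′ p
  ... | k , q = subst (λ z → Orbit σ′ (inj₂ e) (inj₂ z)) q (orbit-iter k e)

  orbit-local : ∀ l l′ → ltail l ≡ ltail l′ → Orbit σ′ (inj₁ l) (inj₁ l′)
  orbit-local l l′ q with ltail l in el
  ... | inj₂ j = let (k , r) = Ok.orbit-new l l′ (trans el q) (isNew-inj₂ el) in local-orbit k l l′ r
  ... | inj₁ i = Orbit-trans (orbit-to-side l i el)
                   (Orbit-trans (orbit-old (side i) (preSide i) (sym (tail-preSide i)))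
                     (orbit-from-preSide l′ i (sym q)))

  σ-orbit′ : ∀ x y → tail′ x ≡ tail′ y → Orbit σ′ x y
  σ-orbit′ (inj₂ e) (inj₂ e′) p = orbit-old e e′ (Fin.↑ʳ-injective nv _ _ p)
  σ-orbit′ (inj₂ e) (inj₁ l)  p with vertex-old (ltail l) (tail e) (sym p)
  ... | i , el = Orbit-trans
        (orbit-old e (preSide i) (trans (Fin.↑ʳ-injective nv _ _ (trans p (cong vertex el))) (sym (tail-preSide i))))
        (orbit-from-preSide l i el)
  σ-orbit′ (inj₁ l) (inj₂ e)  p with vertex-old (ltail l) (tail e) p
  ... | i , el = Orbit-trans (orbit-to-side l i el)
        (orbit-old (side i) e (Fin.↑ʳ-injective nv _ _ (trans (cong vertex (sym el)) p)))
  σ-orbit′ (inj₁ l) (inj₁ l′) p = orbit-local l l′ (vertex-injective (ltail l) (ltail l′) p)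

  tail-onto′ : ∀ w → ∃ λ x → tail′ x ≡ w
  tail-onto′ w with splitAt nv w in e
  ... | inj₁ j = let (l , p) = Ok.tail-onto j in
        inj₁ l , trans (cong vertex p) (trans (cong (join nv n) (sym e)) (Fin.join-splitAt nv n w))
  ... | inj₂ u = let (e₀ , p) = tail-onto u in
        inj₂ e₀ , trans (cong (nv ↑ʳ_) p) (trans (cong (join nv n) (sym e)) (Fin.join-splitAt nv n w))

  φ′ : Dart′ → Dart′
  φ′ x = σ′ (α′ x)

  φ′-atSide : ∀ y → φ′ (atSide y) ≡ atSide (lφ y)
  φ′-atSide (inj₁ l) = refl
  φ′-atSide (inj₂ i) = trans (cong (λ z → σ′ (inj₂ z)) (α-side i)) (σ′-preSide (next3 i))

  φ′-old : ∀ e → (∀ i → e ≢ side i) → φ′ (inj₂ e) ≡ inj₂ (φ e)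
  φ′-old e q = σ′-old (α e) (λ i p → q (prev3 i) (α-injective e (side (prev3 i)) p))

  atSide-injective : ∀ y y′ → atSide y ≡ atSide y′ → y ≡ y′
  atSide-injective (inj₁ l) (inj₁ l′) e = cong inj₁ (Sum.inj₁-injective e)
  atSide-injective (inj₂ i) (inj₂ i′) e = cong inj₂ (side-injective i i′ (Sum.inj₂-injective e))

  face-atSide : ∀ y → φ′ (φ′ (φ′ (atSide y))) ≡ atSide y
  face-atSide y rewrite φ′-atSide y | φ′-atSide (lφ y) | φ′-atSide (lφ (lφ y)) = cong atSide (Ok.face-tri y)

  face-tri′ : ∀ x → φ′ (φ′ (φ′ x)) ≡ x
  face-tri′ (inj₁ l) = face-atSide (inj₁ l)
  face-tri′ (inj₂ e) with among side e
  ... | hit i refl = face-atSide (inj₂ i)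
  ... | miss q rewrite φ′-old e q | φ′-old (φ e) (φ-avoids-sides e q)
                     | φ′-old (φ (φ e)) (φ-avoids-sides (φ e) (φ-avoids-sides e q)) = cong inj₂ (face-tri e)

  face-nofix′ : ∀ x → φ′ x ≢ x
  face-nofix′ (inj₁ l) p = Ok.face-nofix (inj₁ l) (atSide-injective _ _ (trans (sym (φ′-atSide (inj₁ l))) p))
  face-nofix′ (inj₂ e) p with among side e
  ... | hit i refl = Ok.face-nofix (inj₂ i) (atSide-injective _ _ (trans (sym (φ′-atSide (inj₂ i))) p))
  ... | miss q = face-nofix e (Sum.inj₂-injective (trans (sym (φ′-old e q)) p))

  Reach-old : ∀ {e e′} → Reach σ α e e′ → Reach σ′ α′ (inj₂ e) (inj₂ e′)
  Reach-old here = here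
  Reach-old {e} (viaσ r) = Reach-trans (Orbit⇒Reach (orbit-σ e)) (Reach-old r)
  Reach-old (viaα r) = viaα (Reach-old r)

  local-reaches-old : ∀ l → ∃ λ e → Reach σ′ α′ (inj₁ l) (inj₂ e)
  local-reaches-old l with ltail l in el
  ... | inj₁ i = side i , Orbit⇒Reach (orbit-to-side l i el)
  ... | inj₂ j with Ok.new-to-corner l (isNew-inj₂ el)
  ...   | k , l₀ , eq , corner-l₀ with not-new (ltail (lα l₀)) corner-l₀
  ...     | i , ei = side i , Reach-trans (Orbit⇒Reach (local-orbit k l l₀ eq))
                                (viaα (Orbit⇒Reach (orbit-to-side (lα l₀) i ei)))

  old-reaches-local : ∀ l → ∃ λ e → Reach σ′ α′ (inj₂ e) (inj₁ l)
  old-reaches-local l with ltail l in el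
  ... | inj₁ i = preSide i , Orbit⇒Reach (orbit-from-preSide l i el)
  ... | inj₂ j with Ok.corner-to-new l (isNew-inj₂ el)
  ...   | l₀ , k , corner-l₀ , eq with not-new (ltail l₀) corner-l₀
  ...     | i , ei = preSide i , Reach-trans (Orbit⇒Reach (orbit-from-preSide l₀ i ei))
                                   (viaα (Orbit⇒Reach (local-orbit k (lα l₀) l eq)))

  connected′ : ∀ x y → Reach σ′ α′ x y
  connected′ (inj₂ e) (inj₂ e′) = Reach-old (connected e e′)
  connected′ (inj₁ l) (inj₂ e′) = let (e , r) = local-reaches-old l in Reach-trans r (Reach-old (connected e e′))
  connected′ (inj₂ e) (inj₁ l′) = let (e′ , r) = old-reaches-local l′ in Reach-trans (Reach-old (connected e e′)) r
  connected′ (inj₁ l) (inj₁ l′) =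
    let (e , r) = local-reaches-old l ; (e′ , r′) = old-reaches-local l′ in
    Reach-trans r (Reach-trans (Reach-old (connected e e′)) r′)

  no-loop′ : ∀ x → tail′ (α′ x) ≢ tail′ x
  no-loop′ (inj₁ l) p = Ok.no-loop l (vertex-injective _ _ p)
  no-loop′ (inj₂ e) p = no-loop e (Fin.↑ʳ-injective nv _ _ p)

  local-edge-not-old : ∀ l {u w} → vertex (ltail l) ≡ nv ↑ʳ u → vertex (ltail (lα l)) ≡ nv ↑ʳ w → ⊥
  local-edge-not-old l p q with isNew (ltail l) in new-l | Ok.no-corner-edge l
  ... | true  | _ = vertex-new (ltail l) _ p (subst T (sym new-l) tt)
  ... | false | t = vertex-new (ltail (lα l)) _ q t

  no-multi′ : ∀ x y → tail′ x ≡ tail′ y → tail′ (α′ x) ≡ tail′ (α′ y) → x ≡ y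
  no-multi′ (inj₁ l) (inj₁ l′) p q = cong inj₁ (Ok.no-multi l l′ (vertex-injective _ _ p) (vertex-injective _ _ q))
  no-multi′ (inj₁ l) (inj₂ e)  p q = ⊥-elim (local-edge-not-old l p q)
  no-multi′ (inj₂ e) (inj₁ l)  p q = ⊥-elim (local-edge-not-old l (sym p) (sym q))
  no-multi′ (inj₂ e) (inj₂ e′) p q =
    cong inj₂ (no-multi e e′ (Fin.↑ʳ-injective nv _ _ p) (Fin.↑ʳ-injective nv _ _ q))

  darts′ : Dart′ ↔ Fin (2 * (ne + m))
  darts′ = ↔-trans (↔-refl ⊎-↔ darts)
             (↔-trans (↔-sym Fin.+↔⊎) (subst (λ k → Fin (nd + 2 * m) ↔ Fin k) count ↔-refl))
    where
    count : nd + 2 * m ≡ 2 * (ne + m)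
    count rewrite Ok.nd≡2ne = sym (ℕ.*-distribˡ-+ 2 ne m)

  euler′ : 3 * (nv + n) ≡ (ne + m) + 6
  euler′ rewrite ℕ.*-distribˡ-+ 3 nv n | euler | Ok.ne≡3nv = sym (ℕ.+-assoc (3 * nv) m 6)

  inserted : Triangulation (nv + n)
  inserted = record
    { Dart = Dart′ ; _≟_ = Sum.≡-dec Fin._≟_ _≟_ ; m = ne + m ; darts = darts′
    ; tail = tail′ ; α = α′ ; σ = σ′ ; σ⁻¹ = σ⁻¹′
    ; α-invol = α-invol′ ; α-nofix = α-nofix′ ; σσ⁻¹ = σσ⁻¹′ ; σ⁻¹σ = σ⁻¹σ′
    ; σ-tail = σ-tail′ ; σ-orbit = σ-orbit′ ; tail-onto = tail-onto′
    ; face-tri = face-tri′ ; face-nofix = face-nofix′ ; connected = connected′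
    ; euler = euler′ ; no-loop = no-loop′ ; no-multi = no-multi′
    }

  Adjacent-old : ∀ {u w} → Adjacent G u w → Adjacent inserted (nv ↑ʳ u) (nv ↑ʳ w)
  Adjacent-old (e , p , q) = inj₂ e , cong (nv ↑ʳ_) p , cong (nv ↑ʳ_) q

  Adjacent-local : ∀ l → Adjacent inserted (vertex (ltail l)) (vertex (ltail (lα l)))
  Adjacent-local l = inj₁ l , refl , refl

  Adjacent-old⁻¹ : ∀ {u w} → Adjacent inserted (nv ↑ʳ u) (nv ↑ʳ w) → Adjacent G u w
  Adjacent-old⁻¹ (inj₂ e , p , q) = e , Fin.↑ʳ-injective nv _ _ p , Fin.↑ʳ-injective nv _ _ q
  Adjacent-old⁻¹ (inj₁ l , p , q) = ⊥-elim (local-edge-not-old l p q)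

  Adjacent-to-old : ∀ {s w} → (∀ i → w ≢ corner i) → Adjacent inserted s (nv ↑ʳ w) →
                    ∃ λ s₀ → s ≡ nv ↑ʳ s₀ × Adjacent G s₀ w
  Adjacent-to-old w∉ (inj₂ e , p , q) = tail e , sym p , e , refl , Fin.↑ʳ-injective nv _ _ q
  Adjacent-to-old {w = w} w∉ (inj₁ l , p , q) with vertex-old (ltail (lα l)) w q
  ... | i , e = ⊥-elim (w∉ i (sym (Fin.↑ʳ-injective nv _ _ (trans (cong vertex (sym e)) q))))

  Adjacent-to-new : ∀ {s j} → Adjacent inserted s (j ↑ˡ n) → ∃ λ l → ltail (lα l) ≡ inj₂ j × s ≡ vertex (ltail l)
  Adjacent-to-new {j = j} (inj₂ e , p , q) = ⊥-elim (↑ˡ≢↑ʳ j (tail (α e)) (sym q))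
  Adjacent-to-new (inj₁ l , p , q) = l , vertex-injective _ (inj₂ _) q , sym p

  old-Adjacent-to-new : ∀ {u j} → Adjacent inserted (nv ↑ʳ u) (j ↑ˡ n) → ∃ λ i → u ≡ corner i
  old-Adjacent-to-new {u} adj with Adjacent-to-new adj
  ... | l , _ , e with vertex-old (ltail l) u (sym e)
  ...   | i , el = i , Fin.↑ʳ-injective nv _ _ (trans e (cong vertex el))

  neighbours-new : ∀ j {A B C E} →
    (∀ l → ltail (lα l) ≡ inj₂ j → ltail l ≡ A ⊎ ltail l ≡ B ⊎ ltail l ≡ C ⊎ ltail l ≡ E) →
    ∀ s → Adjacent inserted s (j ↑ˡ n) →
    s ≡ vertex A ⊎ s ≡ vertex B ⊎ s ≡ vertex C ⊎ s ≡ vertex E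
  neighbours-new j nbrs s adj with Adjacent-to-new adj
  ... | l , e , refl = cong-⊎⁴ vertex (nbrs l e)

  corner-neighbours : ∀ j → (∀ l → ltail (lα l) ≡ inj₂ j → T (not (isNew (ltail l)))) →
    ∀ s → Adjacent inserted s (j ↑ˡ n) → ∃ λ i → s ≡ nv ↑ʳ corner i
  corner-neighbours j nbrs s adj with Adjacent-to-new adj
  ... | l , e , refl = let (i , el) = not-new (ltail l) (nbrs l e) in i , cong vertex el

  OctahedralTriple-old : ∀ {u v w} → (∀ i → u ≢ corner i) → (∀ i → v ≢ corner i) → (∀ i → w ≢ corner i) →
    OctahedralTriple G u v w → OctahedralTriple inserted (nv ↑ʳ u) (nv ↑ʳ v) (nv ↑ʳ w)
  OctahedralTriple-old u∉ v∉ w∉ O = record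
    { x = nv ↑ʳ x ; y = nv ↑ʳ y ; z = nv ↑ʳ z
    ; nbr-u = lift-nbr u∉ nbr-u ; nbr-v = lift-nbr v∉ nbr-v ; nbr-w = lift-nbr w∉ nbr-w
    ; x-y = Adjacent-old x-y ; y-z = Adjacent-old y-z ; x-z = Adjacent-old x-z }
    where
    open OctahedralTriple O
    lift-nbr : ∀ {q a b c e} → (∀ i → q ≢ corner i) → (∀ s → Adjacent G s q → s ≡ a ⊎ s ≡ b ⊎ s ≡ c ⊎ s ≡ e) →
      ∀ s → Adjacent inserted s (nv ↑ʳ q) → s ≡ nv ↑ʳ a ⊎ s ≡ nv ↑ʳ b ⊎ s ≡ nv ↑ʳ c ⊎ s ≡ nv ↑ʳ e
    lift-nbr q∉ nbr s adj with Adjacent-to-old q∉ adj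
    ... | s₀ , refl , adj₀ = cong-⊎⁴ (nv ↑ʳ_) (nbr s₀ adj₀)

-- Every vertex has degree two, so σ is an involution.
module Triangle where
  tail : Fin 6 → Fin 3
  tail = Vec.lookup (# 0 ∷ # 1 ∷ # 1 ∷ # 2 ∷ # 2 ∷ # 0 ∷ [])

  α σ : Fin 6 → Fin 6
  α = Vec.lookup (# 1 ∷ # 0 ∷ # 3 ∷ # 2 ∷ # 5 ∷ # 4 ∷ [])
  σ = Vec.lookup (# 5 ∷ # 2 ∷ # 1 ∷ # 4 ∷ # 3 ∷ # 0 ∷ [])

  to-zero : ∀ d → Reach σ α d zero
  to-zero zero                             = here
  to-zero (suc zero)                       = viaα here
  to-zero (suc (suc zero))                 = viaσ (viaα here)
  to-zero (suc (suc (suc zero)))           = viaα (viaσ (viaα here))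
  to-zero (suc (suc (suc (suc zero))))     = viaσ (viaα (viaσ (viaα here)))
  to-zero (suc (suc (suc (suc (suc zero))))) = viaσ here

  from-zero : ∀ d → Reach σ α zero d
  from-zero zero                             = here
  from-zero (suc zero)                       = viaα here
  from-zero (suc (suc zero))                 = viaα (viaσ here)
  from-zero (suc (suc (suc zero)))           = viaα (viaσ (viaα here))
  from-zero (suc (suc (suc (suc zero))))     = viaα (viaσ (viaα (viaσ here)))
  from-zero (suc (suc (suc (suc (suc zero))))) = viaσ here

  triangle : Triangulation 3
  triangle = record
    { Dart = Fin 6 ; _≟_ = Fin._≟_ ; m = 3 ; darts = ↔-refl
    ; tail = tail ; α = α ; σ = σ ; σ⁻¹ = σ
    ; α-invol = from-yes (Fin.all? λ d → α (α d) Fin.≟ d)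
    ; α-nofix = from-yes (Fin.all? λ d → ¬? (α d Fin.≟ d))
    ; σσ⁻¹ = from-yes (Fin.all? λ d → σ (σ d) Fin.≟ d)
    ; σ⁻¹σ = from-yes (Fin.all? λ d → σ (σ d) Fin.≟ d)
    ; σ-tail = from-yes (Fin.all? λ d → tail (σ d) Fin.≟ tail d)
    ; σ-orbit = λ d e p →
        let (j , q) = from-yes (Fin.all? λ d → Fin.all? λ e → (tail d Fin.≟ tail e) →-dec
                                 Fin.any? λ (j : Fin 6) → iter σ (toℕ j) d Fin.≟ e) d e p
        in toℕ j , q
    ; tail-onto = from-yes (Fin.all? λ w → Fin.any? λ d → tail d Fin.≟ w)
    ; face-tri = from-yes (Fin.all? λ d → σ (α (σ (α (σ (α d))))) Fin.≟ d)
    ; face-nofix = from-yes (Fin.all? λ d → ¬? (σ (α d) Fin.≟ d))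
    ; connected = λ d e → Reach-trans (to-zero d) (from-zero e)
    ; euler = refl
    ; no-loop = from-yes (Fin.all? λ d → ¬? (tail (α d) Fin.≟ tail d))
    ; no-multi = from-yes (Fin.all? λ d → Fin.all? λ e →
                   (tail d Fin.≟ tail e) →-dec (tail (α d) Fin.≟ tail (α e)) →-dec (d Fin.≟ e))
    }

open Triangle using (triangle)

-- a triangle of new vertices, new vertex j joined to the two corners other than j
octahedronGadget : Gadget
octahedronGadget = record
  { nv = 3 ; ne = 9 ; nd = 18
  ; ltail = Vec.lookup (inj₁ (# 1) ∷ inj₂ (# 2) ∷ inj₂ (# 2) ∷ inj₁ (# 0) ∷ inj₁ (# 2) ∷ inj₂ (# 0) ∷ inj₂ (# 0) ∷ inj₁ (# 1) ∷ inj₁ (# 0) ∷ inj₂ (# 1) ∷ inj₂ (# 1) ∷ inj₁ (# 2) ∷ inj₂ (# 2) ∷ inj₂ (# 1) ∷ inj₂ (# 0) ∷ inj₂ (# 2) ∷ inj₂ (# 1) ∷ inj₂ (# 0) ∷ [])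
  ; lα = Vec.lookup (# 1 ∷ # 0 ∷ # 3 ∷ # 2 ∷ # 5 ∷ # 4 ∷ # 7 ∷ # 6 ∷ # 9 ∷ # 8 ∷ # 11 ∷ # 10 ∷ # 13 ∷ # 12 ∷ # 15 ∷ # 14 ∷ # 17 ∷ # 16 ∷ [])
  ; lσ = Vec.lookup (inj₁ (# 7) ∷ inj₁ (# 2) ∷ inj₁ (# 12) ∷ inj₂ (# 0) ∷ inj₁ (# 11) ∷ inj₁ (# 6) ∷ inj₁ (# 14) ∷ inj₂ (# 1) ∷ inj₁ (# 3) ∷ inj₁ (# 10) ∷ inj₁ (# 16) ∷ inj₂ (# 2) ∷ inj₁ (# 15) ∷ inj₁ (# 9) ∷ inj₁ (# 17) ∷ inj₁ (# 1) ∷ inj₁ (# 13) ∷ inj₁ (# 5) ∷ [])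
  ; lσ⁻¹ = Vec.lookup (inj₂ (# 1) ∷ inj₁ (# 15) ∷ inj₁ (# 1) ∷ inj₁ (# 8) ∷ inj₂ (# 2) ∷ inj₁ (# 17) ∷ inj₁ (# 5) ∷ inj₁ (# 0) ∷ inj₂ (# 0) ∷ inj₁ (# 13) ∷ inj₁ (# 9) ∷ inj₁ (# 4) ∷ inj₁ (# 2) ∷ inj₁ (# 16) ∷ inj₁ (# 6) ∷ inj₁ (# 12) ∷ inj₁ (# 10) ∷ inj₁ (# 14) ∷ [])
  ; entry = Vec.lookup (# 8 ∷ # 0 ∷ # 4 ∷ [])
  ; last = Vec.lookup (# 3 ∷ # 7 ∷ # 11 ∷ [])
  }

octahedronGadget-valid : IsGadget octahedronGadget
octahedronGadget-valid = GadgetDecisions.valid octahedronGadget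

-- A hub (new vertex 0) joined to the three corners and to the new vertices
-- 1, 2, 4, 5; the triangles 1 2 3 and 4 5 6 lean against the corners 0 1 and 1 2.
stepGadget : Gadget
stepGadget = record
  { nv = 7 ; ne = 21 ; nd = 42
  ; ltail = Vec.lookup (inj₁ (# 1) ∷ inj₂ (# 3) ∷ inj₂ (# 3) ∷ inj₁ (# 0) ∷ inj₁ (# 1) ∷ inj₂ (# 0) ∷ inj₂ (# 0) ∷ inj₂ (# 1) ∷ inj₂ (# 1) ∷ inj₁ (# 1) ∷ inj₂ (# 0) ∷ inj₁ (# 0) ∷ inj₁ (# 0) ∷ inj₂ (# 2) ∷ inj₂ (# 2) ∷ inj₂ (# 0) ∷ inj₂ (# 3) ∷ inj₂ (# 2) ∷ inj₂ (# 1) ∷ inj₂ (# 3) ∷ inj₂ (# 2) ∷ inj₂ (# 1) ∷ inj₁ (# 2) ∷ inj₂ (# 6) ∷ inj₂ (# 6) ∷ inj₁ (# 1) ∷ inj₁ (# 2) ∷ inj₂ (# 0) ∷ inj₂ (# 0) ∷ inj₂ (# 4) ∷ inj₂ (# 4) ∷ inj₁ (# 2) ∷ inj₁ (# 1) ∷ inj₂ (# 5) ∷ inj₂ (# 5) ∷ inj₂ (# 0) ∷ inj₂ (# 6) ∷ inj₂ (# 5) ∷ inj₂ (# 4) ∷ inj₂ (# 6) ∷ inj₂ (# 5) ∷ inj₂ (# 4) ∷ [])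
  ; lα = Vec.lookup (# 1 ∷ # 0 ∷ # 3 ∷ # 2 ∷ # 5 ∷ # 4 ∷ # 7 ∷ # 6 ∷ # 9 ∷ # 8 ∷ # 11 ∷ # 10 ∷ # 13 ∷ # 12 ∷ # 15 ∷ # 14 ∷ # 17 ∷ # 16 ∷ # 19 ∷ # 18 ∷ # 21 ∷ # 20 ∷ # 23 ∷ # 22 ∷ # 25 ∷ # 24 ∷ # 27 ∷ # 26 ∷ # 29 ∷ # 28 ∷ # 31 ∷ # 30 ∷ # 33 ∷ # 32 ∷ # 35 ∷ # 34 ∷ # 37 ∷ # 36 ∷ # 39 ∷ # 38 ∷ # 41 ∷ # 40 ∷ [])
  ; lσ = Vec.lookup (inj₁ (# 9) ∷ inj₁ (# 2) ∷ inj₁ (# 16) ∷ inj₂ (# 0) ∷ inj₁ (# 32) ∷ inj₁ (# 6) ∷ inj₁ (# 15) ∷ inj₁ (# 8) ∷ inj₁ (# 18) ∷ inj₁ (# 4) ∷ inj₁ (# 27) ∷ inj₁ (# 12) ∷ inj₁ (# 3) ∷ inj₁ (# 14) ∷ inj₁ (# 20) ∷ inj₁ (# 10) ∷ inj₁ (# 19) ∷ inj₁ (# 13) ∷ inj₁ (# 21) ∷ inj₁ (# 1) ∷ inj₁ (# 17) ∷ inj₁ (# 7) ∷ inj₁ (# 31) ∷ inj₁ (# 24) ∷ inj₁ (# 36) ∷ inj₂ (# 1) ∷ inj₂ (# 2) ∷ inj₁ (# 28) ∷ inj₁ (# 35) ∷ inj₁ (# 30) ∷ inj₁ (# 38) ∷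 inj₁ (# 26) ∷ inj₁ (# 25) ∷ inj₁ (# 34) ∷ inj₁ (# 40) ∷ inj₁ (# 5) ∷ inj₁ (# 39) ∷ inj₁ (# 33) ∷ inj₁ (# 41) ∷ inj₁ (# 23) ∷ inj₁ (# 37) ∷ inj₁ (# 29) ∷ [])
  ; lσ⁻¹ = Vec.lookup (inj₂ (# 1) ∷ inj₁ (# 19) ∷ inj₁ (# 1) ∷ inj₁ (# 12) ∷ inj₁ (# 9) ∷ inj₁ (# 35) ∷ inj₁ (# 5) ∷ inj₁ (# 21) ∷ inj₁ (# 7) ∷ inj₁ (# 0) ∷ inj₁ (# 15) ∷ inj₂ (# 0) ∷ inj₁ (# 11) ∷ inj₁ (# 17) ∷ inj₁ (# 13) ∷ inj₁ (# 6) ∷ inj₁ (# 2) ∷ inj₁ (# 20) ∷ inj₁ (# 8) ∷ inj₁ (# 16) ∷ inj₁ (# 14) ∷ inj₁ (# 18) ∷ inj₂ (# 2) ∷ inj₁ (# 39) ∷ inj₁ (# 23) ∷ inj₁ (# 32) ∷ inj₁ (# 31) ∷ inj₁ (# 10) ∷ inj₁ (# 27) ∷ inj₁ (# 41) ∷ inj₁ (# 29) ∷ inj₁ (# 22) ∷ inj₁ (# 4) ∷ inj₁ (# 37) ∷ inj₁ (# 33) ∷ inj₁ (# 28) ∷ inj₁ (# 24) ∷ inj₁ (# 40) ∷ inj₁ (# 30) ∷ inj₁ (# 36) ∷ inj₁ (# 34) ∷ inj₁ (# 38) ∷ [])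
  ; entry = Vec.lookup (# 11 ∷ # 0 ∷ # 22 ∷ [])
  ; last = Vec.lookup (# 3 ∷ # 25 ∷ # 26 ∷ [])
  }

stepGadget-valid : IsGadget stepGadget
stepGadget-valid = GadgetDecisions.valid stepGadget

stackGadget : Gadget
stackGadget = record
  { nv = 1 ; ne = 3 ; nd = 6
  ; ltail = Vec.lookup (inj₁ (# 1) ∷ inj₂ (# 0) ∷ inj₂ (# 0) ∷ inj₁ (# 0) ∷ inj₁ (# 2) ∷ inj₂ (# 0) ∷ [])
  ; lα = Vec.lookup (# 1 ∷ # 0 ∷ # 3 ∷ # 2 ∷ # 5 ∷ # 4 ∷ [])
  ; lσ = Vec.lookup (inj₂ (# 1) ∷ inj₁ (# 2) ∷ inj₁ (# 5) ∷ inj₂ (# 0) ∷ inj₂ (# 2) ∷ inj₁ (# 1) ∷ [])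
  ; lσ⁻¹ = Vec.lookup (inj₂ (# 1) ∷ inj₁ (# 5) ∷ inj₁ (# 1) ∷ inj₂ (# 0) ∷ inj₂ (# 2) ∷ inj₁ (# 2) ∷ [])
  ; entry = Vec.lookup (# 3 ∷ # 0 ∷ # 4 ∷ [])
  ; last = Vec.lookup (# 3 ∷ # 0 ∷ # 4 ∷ [])
  }

stackGadget-valid : IsGadget stackGadget
stackGadget-valid = GadgetDecisions.valid stackGadget

module OctahedronCertificate {n : ℕ} (G : Triangulation n) (d : Triangulation.Dart G) where
  open Insertion G d octahedronGadget octahedronGadget-valid
  open GadgetDecisions octahedronGadget

  new-triple : OctahedralTriple inserted (vertex (inj₂ (# 0))) (vertex (inj₂ (# 1))) (vertex (inj₂ (# 2)))
  new-triple = record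
    { x = vertex (inj₁ (# 0)) ; y = vertex (inj₁ (# 1)) ; z = vertex (inj₁ (# 2))
    ; nbr-u = neighbours-new (# 0) (from-yes (neighbours? (# 0) (inj₂ (# 1)) (inj₂ (# 2)) (inj₁ (# 1)) (inj₁ (# 2))))
    ; nbr-v = neighbours-new (# 1) (from-yes (neighbours? (# 1) (inj₂ (# 0)) (inj₂ (# 2)) (inj₁ (# 0)) (inj₁ (# 2))))
    ; nbr-w = neighbours-new (# 2) (from-yes (neighbours? (# 2) (inj₂ (# 0)) (inj₂ (# 1)) (inj₁ (# 0)) (inj₁ (# 1))))
    ; x-y = Adjacent-old (corner-adjacent zero)
    ; y-z = Adjacent-old (corner-adjacent (suc zero))
    ; x-z = Adjacent-old (Adjacent-sym G (corner-adjacent (suc (suc zero))))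
    }

module StepCertificates {n : ℕ} (G : Triangulation n) (d : Triangulation.Dart G) where
  open Insertion G d stepGadget stepGadget-valid
  open GadgetDecisions stepGadget
  open Gadget stepGadget using (ltail)

  first-triple : OctahedralTriple inserted (vertex (inj₂ (# 1))) (vertex (inj₂ (# 2))) (vertex (inj₂ (# 3)))
  first-triple = record
    { x = vertex (inj₁ (# 0)) ; y = vertex (inj₁ (# 1)) ; z = vertex (inj₂ (# 0))
    ; nbr-u = neighbours-new (# 1) (from-yes (neighbours? (# 1) (inj₂ (# 2)) (inj₂ (# 3)) (inj₁ (# 1)) (inj₂ (# 0))))
    ; nbr-v = neighbours-new (# 2) (from-yes (neighbours? (# 2) (inj₂ (# 1)) (inj₂ (# 3)) (inj₁ (# 0)) (inj₂ (# 0))))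
    ; nbr-w = neighbours-new (# 3) (from-yes (neighbours? (# 3) (inj₂ (# 1)) (inj₂ (# 2)) (inj₁ (# 0)) (inj₁ (# 1))))
    ; x-y = Adjacent-old (corner-adjacent zero)
    ; y-z = Adjacent-local (# 4)
    ; x-z = Adjacent-local (# 11)
    }

  second-triple : OctahedralTriple inserted (vertex (inj₂ (# 4))) (vertex (inj₂ (# 5))) (vertex (inj₂ (# 6)))
  second-triple = record
    { x = vertex (inj₁ (# 1)) ; y = vertex (inj₁ (# 2)) ; z = vertex (inj₂ (# 0))
    ; nbr-u = neighbours-new (# 4) (from-yes (neighbours? (# 4) (inj₂ (# 5)) (inj₂ (# 6)) (inj₁ (# 2)) (inj₂ (# 0))))
    ; nbr-v = neighbours-new (# 5) (from-yes (neighbours? (# 5) (inj₂ (# 4)) (inj₂ (# 6)) (inj₁ (# 1)) (inj₂ (# 0))))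
    ; nbr-w = neighbours-new (# 6) (from-yes (neighbours? (# 6) (inj₂ (# 4)) (inj₂ (# 5)) (inj₁ (# 1)) (inj₁ (# 2))))
    ; x-y = Adjacent-old (corner-adjacent (suc zero))
    ; y-z = Adjacent-local (# 26)
    ; x-z = Adjacent-local (# 4)
    }

  new-2-6-nonadjacent : ¬ Adjacent inserted (vertex (inj₂ (# 2))) (vertex (inj₂ (# 6)))
  new-2-6-nonadjacent adj with Adjacent-to-new {j = # 6} adj
  ... | l , e₁ , e₂ = from-yes (nonadjacent? (inj₂ (# 2)) (inj₂ (# 6))) l
                        (inj₁ (sym (vertex-injective (inj₂ (# 2)) (ltail l) e₂))) (inj₂ e₁)

size : ℕ → ℕ
size zero    = 6
size (suc t) = 7 + size t

family : (t : ℕ) → Triangulation (size t)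
activeDart : (t : ℕ) → Triangulation.Dart (family t)

family zero    = Insertion.inserted triangle zero octahedronGadget octahedronGadget-valid
family (suc t) = Insertion.inserted (family t) (activeDart t) stepGadget stepGadget-valid

-- the face of the triangle left empty, then the face spanned by corner 0,
-- the hub and corner 2 of the last step gadget
activeDart zero    = inj₂ (# 1)
activeDart (suc t) = inj₁ (# 11)

corners : (t : ℕ) → Fin 3 → Fin (size t)
corners t = Face.corner (family t) (activeDart t)

stacked : (t : ℕ) → Triangulation (1 + size t)
stacked t = Insertion.inserted (family t) (activeDart t) stackGadget stackGadget-valid

chosen : (t : ℕ) → Subset (size t)
chosen zero    = inside ∷ outside ∷ outside ∷ outside ∷ outside ∷ outside ∷ []
chosen (suc t) = outside ∷ outside ∷ inside ∷ outside ∷ outside ∷ outside ∷ inside ∷ chosen t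

-- the vertices lying in none of the octahedral triples: the triangle and the hubs
Spare : (t : ℕ) → Fin (size t) → Set
Spare zero    (suc (suc (suc _)))                          = ⊤
Spare zero    _                                            = ⊥
Spare (suc t) zero                                         = ⊤
Spare (suc t) (suc (suc (suc (suc (suc (suc (suc q))))))) = Spare t q
Spare (suc t) _                                            = ⊥

Triples : (t : ℕ) {N : ℕ} → Triangulation N → (Fin (size t) → Fin N) → Set
Triples zero    G e = OctahedralTriple G (e (# 0)) (e (# 1)) (e (# 2))
Triples (suc t) G e = OctahedralTriple G (e (# 1)) (e (# 2)) (e (# 3)) ×
                      OctahedralTriple G (e (# 4)) (e (# 5)) (e (# 6)) × Triples t G (e ∘ (7 ↑ʳ_))

MeetsTriples : (t : ℕ) → Subset (size t) → Set
MeetsTriples zero    V = Meets V (# 0) (# 1) (# 2)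
MeetsTriples (suc t) V@(_ ∷ _ ∷ _ ∷ _ ∷ _ ∷ _ ∷ _ ∷ V′) =
  Meets V (# 1) (# 2) (# 3) × Meets V (# 4) (# 5) (# 6) × MeetsTriples t V′

Meets-drop : ∀ {n b} {V : Subset n} {p q r} → Meets (b ∷ V) (suc p) (suc q) (suc r) → Meets V p q r
Meets-drop = map drop-there (map drop-there drop-there)

Meets-∈ : ∀ {V : Subset 3} r → r ∈ V → Meets V zero (suc zero) (suc (suc zero))
Meets-∈ zero             r∈V = inj₁ r∈V
Meets-∈ (suc zero)       r∈V = inj₂ (inj₁ r∈V)
Meets-∈ (suc (suc zero)) r∈V = inj₂ (inj₂ r∈V)

Meets-count : ∀ {n b₁ b₂ b₃} {V : Subset n} → Meets (b₁ ∷ b₂ ∷ b₃ ∷ V) zero (suc zero) (suc (suc zero)) →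
              suc ∣ V ∣ ≤ ∣ b₁ ∷ b₂ ∷ b₃ ∷ V ∣
Meets-count {b₂ = b₂} {b₃} {V} (inj₁ here) =
  s≤s (ℕ.≤-trans (∣p∣≤∣x∷p∣ b₃ V) (∣p∣≤∣x∷p∣ b₂ (b₃ ∷ V)))
Meets-count {b₁ = b₁} {b₃ = b₃} {V} (inj₂ (inj₁ (there here))) =
  ℕ.≤-trans (s≤s (∣p∣≤∣x∷p∣ b₃ V)) (∣p∣≤∣x∷p∣ b₁ (inside ∷ b₃ ∷ V))
Meets-count {b₁ = b₁} {b₂} {V = V} (inj₂ (inj₂ (there (there here)))) =
  ℕ.≤-trans (∣p∣≤∣x∷p∣ b₂ (inside ∷ V)) (∣p∣≤∣x∷p∣ b₁ (b₂ ∷ inside ∷ V))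

Meets-count-step : ∀ {n b₀ b₁ b₂ b₃ b₄ b₅ b₆} {V : Subset n} → let W = b₀ ∷ b₁ ∷ b₂ ∷ b₃ ∷ b₄ ∷ b₅ ∷ b₆ ∷ V in
  Meets W (# 1) (# 2) (# 3) → Meets W (# 4) (# 5) (# 6) → suc (suc ∣ V ∣) ≤ ∣ b₁ ∷ b₂ ∷ b₃ ∷ b₄ ∷ b₅ ∷ b₆ ∷ V ∣
Meets-count-step m₁ m₂ =
  ℕ.≤-trans (s≤s (Meets-count (Meets-drop (Meets-drop (Meets-drop (Meets-drop m₂)))))) (Meets-count (Meets-drop m₁))

triples-count : ∀ t (V : Subset (size t)) → MeetsTriples t V → suc (t + t) ≤ ∣ V ∣
triples-count zero    (_ ∷ _ ∷ _ ∷ V) m = ℕ.≤-trans (s≤s z≤n) (Meets-count m)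
triples-count (suc t) (b₀ ∷ W@(_ ∷ _ ∷ _ ∷ _ ∷ _ ∷ _ ∷ V)) (m₁ , m₂ , ms) = begin
  suc (suc t + suc t)      ≡⟨ cong (2 +_) (ℕ.+-suc t t) ⟩
  suc (suc (suc (t + t)))  ≤⟨ s≤s (s≤s (triples-count t V ms)) ⟩
  suc (suc ∣ V ∣)          ≤⟨ Meets-count-step m₁ m₂ ⟩
  ∣ W ∣                    ≤⟨ ∣p∣≤∣x∷p∣ b₀ W ⟩
  ∣ b₀ ∷ W ∣               ∎
  where open ℕ.≤-Reasoning

spare-count : ∀ t (V : Subset (size t)) {q} → MeetsTriples t V → Spare t q → q ∈ V → suc (suc (t + t)) ≤ ∣ V ∣
spare-count zero (_ ∷ _ ∷ _ ∷ _ ∷ _ ∷ _ ∷ []) {suc (suc (suc r))} m _ q∈V =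
  ℕ.≤-trans (s≤s (Meets-count (Meets-∈ r (drop-there (drop-there (drop-there q∈V)))))) (Meets-count m)
spare-count (suc t) (inside ∷ W@(_ ∷ _ ∷ _ ∷ _ ∷ _ ∷ _ ∷ V)) {zero} (m₁ , m₂ , ms) _ here = begin
  suc (suc (suc t + suc t))     ≡⟨ cong (3 +_) (ℕ.+-suc t t) ⟩
  suc (suc (suc (suc (t + t)))) ≤⟨ s≤s (s≤s (s≤s (triples-count t V ms))) ⟩
  suc (suc (suc ∣ V ∣))         ≤⟨ s≤s (Meets-count-step m₁ m₂) ⟩
  suc ∣ W ∣                     ∎
  where open ℕ.≤-Reasoning
spare-count (suc t) (b₀ ∷ W@(_ ∷ _ ∷ _ ∷ _ ∷ _ ∷ _ ∷ V)) {suc (suc (suc (suc (suc (suc (suc q))))))} (m₁ , m₂ , ms) spare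
            (there (there (there (there (there (there (there q∈V))))))) = begin
  suc (suc (suc t + suc t))     ≡⟨ cong (3 +_) (ℕ.+-suc t t) ⟩
  suc (suc (suc (suc (t + t)))) ≤⟨ s≤s (s≤s (spare-count t V ms spare q∈V)) ⟩
  suc (suc ∣ V ∣)               ≤⟨ Meets-count-step m₁ m₂ ⟩
  ∣ W ∣                         ≤⟨ ∣p∣≤∣x∷p∣ b₀ W ⟩
  ∣ b₀ ∷ W ∣                    ∎
  where open ℕ.≤-Reasoning

spare∉chosen : ∀ t q → Spare t q → q ∉ chosen t
spare∉chosen zero    (suc (suc (suc zero)))             _ (there (there (there ())))
spare∉chosen zero    (suc (suc (suc (suc zero))))       _ (there (there (there (there ()))))
spare∉chosen zero    (suc (suc (suc (suc (suc zero))))) _ (there (there (there (there (there ())))))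
spare∉chosen (suc t) (suc (suc (suc (suc (suc (suc (suc q))))))) spare
             (there (there (there (there (there (there (there q∈chosen))))))) = spare∉chosen t q spare q∈chosen

∣chosen∣ : ∀ t → ∣ chosen t ∣ ≡ suc (t + t)
∣chosen∣ zero    = refl
∣chosen∣ (suc t) = trans (cong (2 +_) (∣chosen∣ t)) (cong suc (sym (ℕ.+-suc (suc t) t)))

∈chosen-zero : ∀ {a} → a ∈ chosen zero → a ≡ zero
∈chosen-zero here = refl
∈chosen-zero (there (there (there (there (there (there ()))))))

data ChosenAtStep (t : ℕ) : Fin (size (suc t)) → Set where
  new₂ : ChosenAtStep t (# 2)
  new₆ : ChosenAtStep t (# 6)
  old  : ∀ {a} → a ∈ chosen t → ChosenAtStep t (7 ↑ʳ a)

chosen-at-step : ∀ {t} a → a ∈ chosen (suc t) → ChosenAtStep t a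
chosen-at-step (suc (suc zero)) (there (there here)) = new₂
chosen-at-step (suc (suc (suc (suc (suc (suc zero)))))) (there (there (there (there (there (there here)))))) = new₆
chosen-at-step (suc (suc (suc (suc (suc (suc (suc a))))))) (there (there (there (there (there (there (there a∈))))))) = old a∈

module _ {n : ℕ} (G : Triangulation n) (d : Triangulation.Dart G) (R : Gadget) (ok : IsGadget R) where
  open Insertion G d R ok

  Triples-old : ∀ t (e : Fin (size t) → Fin n) → (∀ q → ¬ Spare t q → ∀ i → e q ≢ corner i) →
                Triples t G e → Triples t inserted (λ q → Gadget.nv R ↑ʳ e q)
  Triples-old zero e avoid O = OctahedralTriple-old (avoid (# 0) λ ()) (avoid (# 1) λ ()) (avoid (# 2) λ ()) O
  Triples-old (suc t) e avoid (O₁ , O₂ , Os) =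
    OctahedralTriple-old (avoid (# 1) λ ()) (avoid (# 2) λ ()) (avoid (# 3) λ ()) O₁ ,
    OctahedralTriple-old (avoid (# 4) λ ()) (avoid (# 5) λ ()) (avoid (# 6) λ ()) O₂ ,
    Triples-old t (e ∘ (7 ↑ʳ_)) (λ q → avoid (7 ↑ʳ q)) Os

Meets-pull : ∀ {N k} {S : Subset N} {V : Subset k} (e : Fin k → Fin N) → (∀ q → e q ∈ S → q ∈ V) →
             ∀ {a b c} → Meets S (e a) (e b) (e c) → Meets V a b c
Meets-pull e pull = map (pull _) (map (pull _) (pull _))

meets-triples : ∀ t {N} {G : Triangulation N} {S} (e : Fin (size t) → Fin N) (V : Subset (size t)) → Triples t G e →
  IsIndependent G S → IsDominating G S → (∀ q → e q ∈ S → q ∈ V) → MeetsTriples t V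
meets-triples zero e V O ind dom pull = Meets-pull e pull (meets-octahedral ind dom O)
meets-triples (suc t) e (b₀ ∷ b₁ ∷ b₂ ∷ b₃ ∷ b₄ ∷ b₅ ∷ b₆ ∷ V) (O₁ , O₂ , Os) ind dom pull =
  Meets-pull e pull (meets-octahedral ind dom O₁) , Meets-pull e pull (meets-octahedral ind dom O₂) ,
  meets-triples t (e ∘ (7 ↑ʳ_)) V Os ind dom λ q m → drop-there⁷ (pull (7 ↑ʳ q) m)
  where
  drop-there⁷ : ∀ {q} → 7 ↑ʳ q ∈ (b₀ ∷ b₁ ∷ b₂ ∷ b₃ ∷ b₄ ∷ b₅ ∷ b₆ ∷ V) → q ∈ V
  drop-there⁷ (there (there (there (there (there (there (there m))))))) = m

record Invariant (t : ℕ) : Set where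
  field
    corners-spare : ∀ i → Spare t (corners t i)
    triples : Triples t (family t) (λ q → q)
    independent : IsIndependent (family t) (chosen t)
    dominates-off-corners : ∀ q → (∃ λ i → q ≡ corners t i) ⊎ q ∈ chosen t ⊎
                                  ∃ λ s → s ∈ chosen t × Adjacent (family t) s q

  corners∉chosen : ∀ i → corners t i ∉ chosen t
  corners∉chosen i = spare∉chosen t _ (corners-spare i)

  avoids-corners : ∀ q → ¬ Spare t q → ∀ i → q ≢ corners t i
  avoids-corners q ¬spare i refl = ¬spare (corners-spare i)

  chosen-not-beside-new : ∀ (R : Gadget) (ok : IsGadget R) {a j} → a ∈ chosen t →
    ¬ Adjacent (Insertion.inserted (family t) (activeDart t) R ok) (Gadget.nv R ↑ʳ a) (j ↑ˡ size t)
  chosen-not-beside-new R ok a∈chosen adj =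
    let (i , a≡corner) = Insertion.old-Adjacent-to-new (family t) (activeDart t) R ok adj
    in corners∉chosen i (subst (_∈ chosen t) a≡corner a∈chosen)

invariant-zero : Invariant zero
invariant-zero = record
  { corners-spare = λ { zero → tt ; (suc zero) → tt ; (suc (suc zero)) → tt }
  ; triples = OctahedronCertificate.new-triple triangle zero
  ; independent = λ a b a∈ b∈ adj →
      Adjacent-irrefl inserted (subst₂ (Adjacent inserted) (∈chosen-zero a∈) (∈chosen-zero b∈) adj)
  ; dominates-off-corners = dominated
  }
  where
  open Insertion triangle zero octahedronGadget octahedronGadget-valid
  dominated : ∀ q → (∃ λ i → q ≡ corners zero i) ⊎ q ∈ chosen zero ⊎
                    ∃ λ s → s ∈ chosen zero × Adjacent inserted s q
  dominated zero                                = inj₂ (inj₁ here)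
  dominated (suc zero)                          = inj₂ (inj₂ (zero , here , Adjacent-local (# 17)))
  dominated (suc (suc zero))                    = inj₂ (inj₂ (zero , here , Adjacent-local (# 14)))
  dominated (suc (suc (suc zero)))              = inj₁ (suc zero , refl)
  dominated (suc (suc (suc (suc zero))))        = inj₁ (zero , refl)
  dominated (suc (suc (suc (suc (suc zero)))))  = inj₁ (suc (suc zero) , refl)

module Step (t : ℕ) (I : Invariant t) where
  open Invariant I
  open Insertion (family t) (activeDart t) stepGadget stepGadget-valid
  open StepCertificates (family t) (activeDart t)

  2∈chosen : # 2 ∈ chosen (suc t)
  2∈chosen = there (there here)

  6∈chosen : # 6 ∈ chosen (suc t)
  6∈chosen = there (there (there (there (there (there here)))))

  there⁷ : ∀ {a} → a ∈ chosen t → 7 ↑ʳ a ∈ chosen (suc t)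
  there⁷ a∈ = there (there (there (there (there (there (there a∈))))))

  chosen-nonadjacent : ∀ {a b} → ChosenAtStep t a → ChosenAtStep t b → ¬ Adjacent inserted a b
  chosen-nonadjacent (old a∈) (old b∈) adj = independent _ _ a∈ b∈ (Adjacent-old⁻¹ adj)
  chosen-nonadjacent (old a∈) new₂     adj = chosen-not-beside-new stepGadget stepGadget-valid {j = # 2} a∈ adj
  chosen-nonadjacent (old a∈) new₆     adj = chosen-not-beside-new stepGadget stepGadget-valid {j = # 6} a∈ adj
  chosen-nonadjacent new₂     (old b∈) adj =
    chosen-not-beside-new stepGadget stepGadget-valid {j = # 2} b∈ (Adjacent-sym inserted adj)
  chosen-nonadjacent new₆     (old b∈) adj =
    chosen-not-beside-new stepGadget stepGadget-valid {j = # 6} b∈ (Adjacent-sym inserted adj)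
  chosen-nonadjacent new₂     new₂     adj = Adjacent-irrefl inserted adj
  chosen-nonadjacent new₆     new₆     adj = Adjacent-irrefl inserted adj
  chosen-nonadjacent new₂     new₆     adj = new-2-6-nonadjacent adj
  chosen-nonadjacent new₆     new₂     adj = new-2-6-nonadjacent (Adjacent-sym inserted adj)

  old-corner-dominated : ∀ i → ∃ λ s → s ∈ chosen (suc t) × Adjacent inserted s (7 ↑ʳ corners t i)
  old-corner-dominated zero             = # 2 , 2∈chosen , Adjacent-local (# 13)
  old-corner-dominated (suc zero)       = # 6 , 6∈chosen , Adjacent-local (# 24)
  old-corner-dominated (suc (suc zero)) = # 6 , 6∈chosen , Adjacent-local (# 23)

  Dominated : Fin (size (suc t)) → Set
  Dominated q = q ∈ chosen (suc t) ⊎ ∃ λ s → s ∈ chosen (suc t) × Adjacent inserted s q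

  old-dominated : ∀ {q} → (∃ λ i → q ≡ corners t i) ⊎ q ∈ chosen t ⊎ (∃ λ s → s ∈ chosen t × Adjacent (family t) s q) →
                  Dominated (7 ↑ʳ q)
  old-dominated (inj₁ (i , refl))            = inj₂ (old-corner-dominated i)
  old-dominated (inj₂ (inj₁ q∈))             = inj₁ (there⁷ q∈)
  old-dominated (inj₂ (inj₂ (s , s∈ , adj))) = inj₂ (7 ↑ʳ s , there⁷ s∈ , Adjacent-old adj)

  dominated : ∀ q → Dominated q
  dominated zero                                        = inj₂ (# 2 , 2∈chosen , Adjacent-local (# 14))
  dominated (suc zero)                                  = inj₂ (# 2 , 2∈chosen , Adjacent-local (# 20))
  dominated (suc (suc zero))                            = inj₁ 2∈chosen
  dominated (suc (suc (suc zero)))                      = inj₂ (# 2 , 2∈chosen , Adjacent-local (# 17))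
  dominated (suc (suc (suc (suc zero))))                = inj₂ (# 6 , 6∈chosen , Adjacent-local (# 39))
  dominated (suc (suc (suc (suc (suc zero)))))          = inj₂ (# 6 , 6∈chosen , Adjacent-local (# 36))
  dominated (suc (suc (suc (suc (suc (suc zero))))))    = inj₁ 6∈chosen
  dominated (suc (suc (suc (suc (suc (suc (suc q))))))) = old-dominated (dominates-off-corners q)

  invariant-suc : Invariant (suc t)
  invariant-suc = record
    { corners-spare = λ { zero → corners-spare zero ; (suc zero) → tt ; (suc (suc zero)) → corners-spare (suc (suc zero)) }
    ; triples = first-triple , second-triple ,
                Triples-old (family t) (activeDart t) stepGadget stepGadget-valid t (λ q → q) avoids-corners triples
    ; independent = λ a b a∈ b∈ → chosen-nonadjacent (chosen-at-step a a∈) (chosen-at-step b b∈)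
    ; dominates-off-corners = inj₂ ∘ dominated
    }

invariant : ∀ t → Invariant t
invariant zero    = invariant-zero
invariant (suc t) = Step.invariant-suc t (invariant t)

module Stacked (t : ℕ) where
  open Invariant (invariant t)
  open Insertion (family t) (activeDart t) stackGadget stackGadget-valid
  open GadgetDecisions stackGadget using (only-corner-neighbours?)

  chosen′ : Subset (suc (size t))
  chosen′ = inside ∷ chosen t

  chosen′-independent : IsIndependent inserted chosen′
  chosen′-independent zero    zero    here       here       adj = Adjacent-irrefl inserted adj
  chosen′-independent zero    (suc b) here       (there b∈) adj =
    chosen-not-beside-new stackGadget stackGadget-valid {j = zero} b∈ (Adjacent-sym inserted adj)
  chosen′-independent (suc a) zero    (there a∈) here       adj =
    chosen-not-beside-new stackGadget stackGadget-valid {j = zero} a∈ adj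
  chosen′-independent (suc a) (suc b) (there a∈) (there b∈) adj = independent a b a∈ b∈ (Adjacent-old⁻¹ adj)

  apex-corner : ∀ i → Adjacent inserted zero (suc (corners t i))
  apex-corner zero             = Adjacent-local (# 2)
  apex-corner (suc zero)       = Adjacent-local (# 1)
  apex-corner (suc (suc zero)) = Adjacent-local (# 5)

  old-dominated : ∀ {q} → (∃ λ i → q ≡ corners t i) ⊎ q ∈ chosen t ⊎ (∃ λ s → s ∈ chosen t × Adjacent (family t) s q) →
                  suc q ∈ chosen′ ⊎ ∃ λ s → s ∈ chosen′ × Adjacent inserted s (suc q)
  old-dominated (inj₁ (i , refl))            = inj₂ (zero , here , apex-corner i)
  old-dominated (inj₂ (inj₁ q∈))             = inj₁ (there q∈)
  old-dominated (inj₂ (inj₂ (s , s∈ , adj))) = inj₂ (suc s , there s∈ , Adjacent-old adj)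

  chosen′-dominating : IsDominating inserted chosen′
  chosen′-dominating zero    = inj₁ here
  chosen′-dominating (suc q) = old-dominated (dominates-off-corners q)

  -- The apex is dominated either by itself or by a corner of the active face,
  -- and those corners are spare.
  lower-bound : ∀ S → IsIndependent inserted S → IsDominating inserted S → suc (suc (t + t)) ≤ ∣ S ∣
  lower-bound (s₀ ∷ V) ind dom = apex-dominated (dom zero)
    where
    meets : MeetsTriples t V
    meets = meets-triples t suc V
      (Triples-old (family t) (activeDart t) stackGadget stackGadget-valid t (λ q → q) avoids-corners triples)
      ind dom (λ q → drop-there)
    apex-dominated : zero ∈ s₀ ∷ V ⊎ (∃ λ s → s ∈ s₀ ∷ V × Adjacent inserted s zero) → suc (suc (t + t)) ≤ ∣ s₀ ∷ V ∣
    apex-dominated (inj₁ here) = s≤s (triples-count t V meets)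
    apex-dominated (inj₂ (s , s∈S , adj)) =
      let (i , s≡corner) = corner-neighbours zero (from-yes (only-corner-neighbours? zero)) s adj in
      ℕ.≤-trans (spare-count t V meets (corners-spare i) (drop-there (subst (_∈ s₀ ∷ V) s≡corner s∈S)))
                (∣p∣≤∣x∷p∣ s₀ V)

  indDomNumber : IsIndDomNumber (ToPlane.plane inserted) (suc (suc (t + t)))
  indDomNumber = ToPlane.IsIndDomNumber-plane inserted
         (chosen′ , (chosen′-independent , chosen′-dominating) , cong suc (∣chosen∣ t)) lower-bound

size≡ : ∀ t → size t ≡ 7 * t + 6
size≡ zero    = refl
size≡ (suc t) = trans (cong (7 +_) (size≡ t)) (step t)
  where
  step : ∀ t → 7 + (7 * t + 6) ≡ 7 * suc t + 6
  step = solve-∀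

≤size : ∀ t → t ≤ size t
≤size zero    = z≤n
≤size (suc t) = s≤s (ℕ.≤-trans (≤size t) (ℕ.m≤n+m (size t) 6))

theorem9 : ∀ (N : ℕ) → Σ ℕ λ n → N ≤ n × Σ (PlaneTriangulation n) λ G → Σ ℕ λ ι → IsIndDomNumber G ι × 7 * ι ≡ 2 * n
theorem9 N = suc (size N) , ℕ.m≤n⇒m≤1+n (≤size N) , ToPlane.plane (stacked N) , suc (suc (N + N)) , Stacked.indDomNumber N ,
             trans (ratio N) (cong (λ k → 2 * suc k) (sym (size≡ N)))
  where
  ratio : ∀ N → 7 * suc (suc (N + N)) ≡ 2 * suc (7 * N + 6)
  ratio = solve-∀
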